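{- Let $n=2^a$ for some nonnegative integer $a$. Then no transitive avoidance game on $n$ points is a Player I win.
   Context: An avoidance game consists of a finite set $X$ (the board) and a family $\mathcal{L}$ of subsets of $X$ (the lines). Two players, Player I and Player II, alternately claim previously unclaimed points of $X$, Player I moving first. The first player to have claimed all points of some line loses; if all points have been claimed and neither player has completed a line, the game is a draw. The game is transitive if its automorphism group (the group of permutations of $X$ mapping $\mathcal{L}$ onto $\mathcal{L}$) acts transitively on $X$. The game is a Player I win if Player I has a strategy guaranteeing that Player II loses. -}

module Defs where

open import Data.Nat using (ℕ)
open import Data.Fin using (Fin)
open import Data.Fin.Subset using (Subset) renaming (_∈_ to _∈ₛ_)
open import Data.Fin.Permutation using (Permutation′; _⟨$⟩ʳ_; _⟨$⟩ˡ_)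
open import Data.Vec using (tabulate; lookup)
open import Data.List using (List)
open import Data.List.Membership.Propositional using (_∈_)
open import Data.List.Relation.Unary.Any using (Any)
open import Data.Maybe using (Maybe; just; nothing)
open import Data.Product using (Σ; _×_; ∃-syntax)
open import Data.Empty using (⊥)
open import Relation.Binary.PropositionalEquality using (_≡_)
open import Relation.Nullary using (¬_)
open import Relation.Nullary.Decidable using (⌊_⌋)
open import Data.Fin using (_≟_)
open import Data.Bool using (if_then_else_)
open import Data.Sum using (_⊎_)

record AvoidanceGame (n : ℕ) : Set where
  field
    lines : List (Subset n)

open AvoidanceGame public

image : {n : ℕ} → Permutation′ n → Subset n → Subset n
image σ L = tabulate (λ j → lookup L (σ ⟨$⟩ˡ j))

IsAutomorphism : {n : ℕ} → AvoidanceGame n → Permutation′ n → Set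
IsAutomorphism G σ =
  (∀ L → L ∈ lines G → image σ L ∈ lines G) ×
  (∀ M → M ∈ lines G → ∃[ L ] (L ∈ lines G × image σ L ≡ M))

Transitive : {n : ℕ} → AvoidanceGame n → Set
Transitive {n} G =
  ∀ (x y : Fin n) → ∃[ σ ] (IsAutomorphism G σ × σ ⟨$⟩ʳ x ≡ y)

data Player : Set where
  I II : Player

Position : ℕ → Set
Position n = Fin n → Maybe Player

start : {n : ℕ} → Position n
start _ = nothing

claim : {n : ℕ} → Position n → Fin n → Player → Position n
claim s x p y = if ⌊ y ≟ x ⌋ then just p else s y

Completed : {n : ℕ} → AvoidanceGame n → Position n → Player → Set
Completed G s p = Any (λ L → ∀ x → x ∈ₛ L → s x ≡ just p) (lines G)

Unclaimed : {n : ℕ} → Position n → Fin n → Set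
Unclaimed s x = s x ≡ nothing

-- Player I can force a win (Player II completes a line first) from
-- position s, with the indicated player to move and no line yet completed.
data IWinsFrom {n : ℕ} (G : AvoidanceGame n) : Position n → Player → Set where
  moveI : ∀ {s} (x : Fin n) → Unclaimed s x →
          ¬ Completed G (claim s x I) I →
          IWinsFrom G (claim s x I) II →
          IWinsFrom G s I
  moveII : ∀ {s} →
           ∃[ x ] Unclaimed s x →
           (∀ x → Unclaimed s x →
              Completed G (claim s x II) II ⊎ IWinsFrom G (claim s x II) I) →
           IWinsFrom G s II


PlayerIWin : {n : ℕ} → AvoidanceGame n → Set
PlayerIWin G = IWinsFrom G start I

-- For a = 0 Player I's first move ends the game. For a ≥ 1 we find a
-- fixed-point-free involutive automorphism τ; then Player II answers every
-- move x by τ x (MirrorStrategy), which keeps the position symmetric under τ,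
-- so Player II can only complete a line right after Player I completed its
-- preimage under τ.
--
-- In a finite group (FiniteGroup) we build
-- a Sylow 2-subgroup P as a tower of index-2 extensions, using that a 2-group
-- fixes as many points as there are, mod 2 (FixedPoints). A 2-adic count
-- (Parity.two-part-divides) shows that P is transitive on the 2^a points;
-- P centralises an involution z, and an element commuting with a transitive
-- group fixes either no point or all of them, so z moves every point.

module Submission where

open import Defs
open import Level using (0ℓ)
open import Algebra.Core using (Op₁; Op₂)
open import Algebra.Bundles using (Group)
open import Algebra.Structures using (IsGroup)
open import Data.Nat using (ℕ; zero; suc; _^_)
open import Data.Fin using (Fin; zero) renaming (_≟_ to _≟F_)
open import Data.Fin.Subset using (Subset) renaming (_∈_ to _∈ₛ_)
open import Data.Vec using (tabulate; lookup)
open import Data.List using (List)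
open import Data.List.Membership.Propositional using (_∈_; _∉_)
open import Data.List.Relation.Unary.Unique.Propositional using (Unique)
open import Data.Product using (_,_)
open import Function using (_∘_)
open import Relation.Binary.Definitions using (DecidableEquality)
open import Relation.Binary.PropositionalEquality using (_≡_; refl)
open import Relation.Nullary using (¬_)

module Parity where

  open import Data.Nat using (ℕ; zero; suc; _+_; _*_; _^_; _≤_; _<_; s≤s; z≤n)
  open import Data.Nat.Properties
    using (*-comm; *-assoc; *-identityʳ; +-comm; +-mono-≤; ≤-trans; m≤m+n; m^n≢0; m^n>0; *-commutativeSemigroup)
  open import Algebra.Properties.CommutativeSemigroup *-commutativeSemigroup
    using (x∙yz≈y∙xz; xy∙z≈y∙xz)
  open import Data.Nat.Divisibility
    using (_∣_; divides; divides-refl; ∣-trans; m∣m*n; *-cancelˡ-∣; *-cancelʳ-∣; *-monoʳ-∣)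
  open import Data.Bool using (Bool; true; false; not; _∨_; _xor_)
  open import Data.Bool.Properties using (∨-zeroʳ; not-involutive)
  open import Relation.Binary.PropositionalEquality
  open ≡-Reasoning

  -- Parity as a Boolean, so that "same parity" is an equation of Booleans.
  even : ℕ → Bool
  even zero    = true
  even (suc n) = not (even n)

  even-+ : ∀ m n → even (m + n) ≡ not (even m xor even n)
  even-+ zero    n = sym (not-involutive (even n))
  even-+ (suc m) n rewrite even-+ m n with even m | even n
  ... | true  | true  = refl
  ... | true  | false = refl
  ... | false | true  = refl
  ... | false | false = refl

  even-* : ∀ m n → even (m * n) ≡ even m ∨ even n
  even-* zero    n = refl
  even-* (suc m) n rewrite even-+ n (m * n) | even-* m n with even m | even n
  ... | true  | true  = refl
  ... | true  | false = refl
  ... | false | true  = refl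
  ... | false | false = refl

  2∣⇒even : ∀ {m} → 2 ∣ m → even m ≡ true
  2∣⇒even (divides-refl q) = trans (even-* q 2) (∨-zeroʳ (even q))

  even⇒2∣ : ∀ m → even m ≡ true → 2 ∣ m
  even⇒2∣ zero          _  = divides 0 refl
  even⇒2∣ (suc (suc m)) ev with even⇒2∣ m (trans (sym (not-involutive (even m))) ev)
  ... | divides-refl q = divides (suc q) refl

  2^a∣odd*o⇒2^a∣o : ∀ a {r o} → even r ≡ false → 2 ^ a ∣ r * o → 2 ^ a ∣ o
  2^a∣odd*o⇒2^a∣o zero    {o = o} _ _ = divides o (sym (*-identityʳ o))
  2^a∣odd*o⇒2^a∣o (suc a) {r} {o} odd div
    with even⇒2∣ o (even-factor (2∣⇒even (∣-trans (m∣m*n (2 ^ a)) div)))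
    where
    even-factor : even (r * o) ≡ true → even o ≡ true
    even-factor ev = trans (sym (cong (_∨ even o) odd)) (trans (sym (even-* r o)) ev)
  ... | divides-refl h = subst (2 ^ suc a ∣_) (*-comm 2 h)
          (*-monoʳ-∣ 2 (2^a∣odd*o⇒2^a∣o a {r} {h} odd (*-cancelˡ-∣ 2 (subst (2 ^ suc a ∣_) (regroup r h) div))))
    where
    regroup : ∀ r h → r * (h * 2) ≡ 2 * (r * h)
    regroup r h = begin
      r * (h * 2) ≡⟨ sym (*-assoc r h 2) ⟩
      r * h * 2   ≡⟨ *-comm (r * h) 2 ⟩
      2 * (r * h) ∎

  -- The 2-adic core of the Sylow argument: if a finite set has size r·2^k with
  -- r odd and also size 2^a·h, then every o with o·h a multiple of 2^k is a
  -- multiple of 2^a.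
  two-part-divides : ∀ {a k r h o m} → even r ≡ false →
    r * 2 ^ k ≡ 2 ^ a * h → m * 2 ^ k ≡ o * h → 2 ^ a ∣ o
  two-part-divides {a} {k} {r} {h} {o} {m} odd sizes multiple =
    2^a∣odd*o⇒2^a∣o a {r} {o} odd (*-cancelʳ-∣ (2 ^ k) {{m^n≢0 2 k}} (divides m (begin
      r * o * 2 ^ k         ≡⟨ xy∙z≈y∙xz r o (2 ^ k) ⟩
      o * (r * 2 ^ k)       ≡⟨ cong (o *_) sizes ⟩
      o * (2 ^ a * h)       ≡⟨ x∙yz≈y∙xz o (2 ^ a) h ⟩
      2 ^ a * (o * h)       ≡⟨ cong (2 ^ a *_) (sym multiple) ⟩
      2 ^ a * (m * 2 ^ k)   ≡⟨ x∙yz≈y∙xz (2 ^ a) m (2 ^ k) ⟩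
      m * (2 ^ a * 2 ^ k)   ∎)))

  n<2^n : ∀ n → n < 2 ^ n
  n<2^n zero    = s≤s z≤n
  n<2^n (suc n) = subst (_≤ 2 ^ suc n) (+-comm (suc n) 1)
    (+-mono-≤ (n<2^n n) (≤-trans (m^n>0 2 n) (m≤m+n (2 ^ n) 0)))

module Counting {A : Set} (_≟_ : DecidableEquality A) where

  open import Data.Nat using (ℕ; suc; _+_; _*_; _≤_; s≤s)
  open import Data.Nat.Properties using (≤-refl; ≤-trans; ≤-reflexive; <-irrefl; +-suc; n≤1+n)
  open import Data.Bool using (true; false; not)
  open import Data.Bool.Properties using (not-involutive)
  open import Data.List using (List; []; _∷_; length; filter)
  open import Data.List.Properties using (length-filter; filter-reject; filter-all)
  open import Data.List.Membership.Propositional using (_∈_)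
  open import Data.List.Membership.Propositional.Properties using (∈-filter⁺; ∈-filter⁻)
  open import Data.List.Membership.DecPropositional _≟_ using (_∈?_)
  open import Data.List.Membership.Propositional.Properties.WithK using (unique∧set⇒bag)
  open import Data.List.Relation.Binary.Subset.Propositional using (_⊆_)
  open import Data.List.Relation.Binary.BagAndSetEquality using (∼bag⇒↭)
  open import Data.List.Relation.Binary.Permutation.Propositional.Properties using (↭-length)
  open import Data.List.Relation.Unary.Unique.Propositional using (Unique; []; _∷_)
  open import Data.List.Relation.Unary.Unique.Propositional.Properties using (filter⁺)
  open import Data.List.Relation.Unary.All as All using (All)
  open import Data.List.Relation.Unary.Any using (here; there)
  open import Data.Product using (∃; _×_; _,_; proj₁; proj₂)
  open import Data.Empty using (⊥; ⊥-elim)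
  open import Function.Bundles using (mk⇔)
  open import Relation.Binary.PropositionalEquality
  open import Relation.Nullary using (¬_; yes; no)
  open import Relation.Nullary.Decidable using (¬?)
  open import Relation.Unary using (Decidable)
  open Parity using (even)

  same-members⇒same-length : ∀ {xs ys : List A} → Unique xs → Unique ys →
    xs ⊆ ys → ys ⊆ xs → length xs ≡ length ys
  same-members⇒same-length uxs uys xs⊆ys ys⊆xs =
    ↭-length (∼bag⇒↭ (unique∧set⇒bag uxs uys (mk⇔ xs⊆ys ys⊆xs)))

  ⊆⇒length-≤ : ∀ {xs ys : List A} → Unique xs → Unique ys → xs ⊆ ys → length xs ≤ length ys
  ⊆⇒length-≤ {xs} {ys} uxs uys xs⊆ys = ≤-trans
    (≤-reflexive (same-members⇒same-length uxs (filter⁺ (_∈? xs) uys)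
      (λ x∈xs → ∈-filter⁺ (_∈? xs) (xs⊆ys x∈xs) x∈xs)
      (λ x∈ys∩xs → proj₂ (∈-filter⁻ (_∈? xs) {xs = ys} x∈ys∩xs))))
    (length-filter (_∈? xs) ys)

  ⊆∧length-≥⇒⊇ : ∀ {xs ys : List A} → Unique xs → Unique ys →
    xs ⊆ ys → length ys ≤ length xs → ys ⊆ xs
  ⊆∧length-≥⇒⊇ {xs} {ys} uxs uys xs⊆ys ys≤xs {y} y∈ys with y ∈? xs
  ... | yes y∈xs = y∈xs
  ... | no  y∉xs = ⊥-elim (<-irrefl refl (≤-trans (⊆⇒length-≤ (y∉ ∷ uxs) uys y∷xs⊆ys) ys≤xs))
    where
    y∉ : All (λ z → ¬ y ≡ z) xs
    y∉ = All.tabulate λ z∈xs y≡z → y∉xs (subst (_∈ xs) (sym y≡z) z∈xs)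
    y∷xs⊆ys : (y ∷ xs) ⊆ ys
    y∷xs⊆ys (here refl) = y∈ys
    y∷xs⊆ys (there z∈xs) = xs⊆ys z∈xs

  length-split : ∀ {P : A → Set} (P? : Decidable P) (xs : List A) →
    length xs ≡ length (filter P? xs) + length (filter (¬? ∘ P?) xs)
  length-split P? [] = refl
  length-split P? (x ∷ xs) with P? x
  ... | yes _ = cong suc (length-split P? xs)
  ... | no  _ = trans (cong suc (length-split P? xs)) (sym (+-suc _ _))

  remove : A → List A → List A
  remove a = filter (λ z → ¬? (z ≟ a))

  remove-⊆ : ∀ {a} xs → remove a xs ⊆ xs
  remove-⊆ {a} xs z∈ = proj₁ (∈-filter⁻ (λ z → ¬? (z ≟ a)) {xs = xs} z∈)

  remove-≢ : ∀ {a} xs {z} → z ∈ remove a xs → ¬ z ≡ a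
  remove-≢ {a} xs z∈ = proj₂ (∈-filter⁻ (λ z → ¬? (z ≟ a)) {xs = xs} z∈)

  remove-∈ : ∀ {a} {xs z} → z ∈ xs → ¬ z ≡ a → z ∈ remove a xs
  remove-∈ {a} = ∈-filter⁺ (λ z → ¬? (z ≟ a))

  length-remove : ∀ {xs : List A} {a} → Unique xs → a ∈ xs → length xs ≡ suc (length (remove a xs))
  length-remove {x ∷ xs} {a} (x∉xs ∷ uxs) (here refl) =
    cong suc (cong length (sym (trans (filter-reject (λ z → ¬? (z ≟ a)) (λ ne → ne refl))
      (filter-all (λ z → ¬? (z ≟ a)) (All.map (λ a≢z z≡a → a≢z (sym z≡a)) x∉xs)))))
  length-remove {x ∷ xs} {a} (x∉xs ∷ uxs) (there a∈xs) with x ≟ a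
  ... | yes refl = ⊥-elim (All.lookup x∉xs a∈xs refl)
  ... | no  _    = cong suc (length-remove uxs a∈xs)

  module _ {B : Set} (_≟B_ : DecidableEquality B) (f : A → B) where

    fibre : B → List A → List A
    fibre y = filter (λ x → f x ≟B y)

    fibre-count : (xs : List A) (ys : List B) (c : ℕ) → Unique xs →
      Unique ys →
      (∀ {x} → x ∈ xs → f x ∈ ys) →
      (∀ {y} → y ∈ ys → length (fibre y xs) ≡ c) →
      length xs ≡ length ys * c
    fibre-count []       []       c _   _          _    _     = refl
    fibre-count (x ∷ xs) []       c _   _          into _     with into (here refl)
    ... | ()
    fibre-count xs       (y ∷ ys) c uxs (y∉ys ∷ uys) into sizes =
      trans (length-split (λ x → f x ≟B y) xs)
        (cong₂ _+_ (sizes (here refl)) (fibre-count rest ys c (filter⁺ _ uxs) uys into′ sizes′))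
      where
      rest : List A
      rest = filter (λ x → ¬? (f x ≟B y)) xs
      rest⊆xs : rest ⊆ xs
      rest⊆xs x∈ = proj₁ (∈-filter⁻ (λ x → ¬? (f x ≟B y)) {xs = xs} x∈)
      into′ : ∀ {x} → x ∈ rest → f x ∈ ys
      into′ x∈ with into (rest⊆xs x∈)
      ... | here fx≡y = ⊥-elim (proj₂ (∈-filter⁻ (λ x → ¬? (f x ≟B y)) {xs = xs} x∈) fx≡y)
      ... | there fx∈ys = fx∈ys
      -- Over y′ ≠ y, the fibre is unchanged by discarding the fibre over y.
      sizes′ : ∀ {y′} → y′ ∈ ys → length (fibre y′ rest) ≡ c
      sizes′ {y′} y′∈ys = trans
        (same-members⇒same-length (filter⁺ _ (filter⁺ _ uxs)) (filter⁺ _ uxs)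
          (λ x∈ → let x∈rest , fx≡y′ = ∈-filter⁻ (λ x → f x ≟B y′) {xs = rest} x∈
                  in ∈-filter⁺ (λ x → f x ≟B y′) (rest⊆xs x∈rest) fx≡y′)
          (λ x∈ → let x∈xs , fx≡y′ = ∈-filter⁻ (λ x → f x ≟B y′) {xs = xs} x∈
                  in ∈-filter⁺ (λ x → f x ≟B y′)
                       (∈-filter⁺ (λ x → ¬? (f x ≟B y)) x∈xs
                         (λ fx≡y → All.lookup y∉ys y′∈ys (trans (sym fx≡y) fx≡y′)))
                       fx≡y′))
        (sizes (there y′∈ys))

  fixed-points : (A → A) → List A → List A
  fixed-points f = filter (λ y → f y ≟ y)

  record InvolutionOn (f : A → A) (S : List A) : Set where
    field
      closed     : ∀ {y} → y ∈ S → f y ∈ S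
      involutive : ∀ {y} → y ∈ S → f (f y) ≡ y

  -- Dropping a fixed head y leaves an involution on the tail, since f z ≡ y
  -- forces z ≡ f y ≡ y.
  drop-fixed-head : ∀ {f y T} → All (λ z → ¬ y ≡ z) T → InvolutionOn f (y ∷ T) → f y ≡ y → InvolutionOn f T
  drop-fixed-head {f} {y} {T} y∉T inv fy≡y = record
    { closed = T-closed ; involutive = λ z∈T → involutive (there z∈T) }
    where
    open InvolutionOn inv
    T-closed : ∀ {z} → z ∈ T → f z ∈ T
    T-closed {z} z∈T with closed (there z∈T)
    ... | here fz≡y = ⊥-elim (All.lookup y∉T z∈T
                        (sym (trans (sym (involutive (there z∈T))) (trans (cong f fz≡y) fy≡y))))
    ... | there fz∈T = fz∈T

  module DropPair {f y T} (y∉T : All (λ z → ¬ y ≡ z) T) (uT : Unique T)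
    (inv : InvolutionOn f (y ∷ T)) (fy≢y : ¬ f y ≡ y) where

    open InvolutionOn inv

    partner∈ : f y ∈ T
    partner∈ with closed (here refl)
    ... | here fy≡y = ⊥-elim (fy≢y fy≡y)
    ... | there fy∈T = fy∈T

    rest : List A
    rest = remove (f y) T

    rest-involution : InvolutionOn f rest
    rest-involution = record
      { closed = rest-closed
      ; involutive = λ z∈ → involutive (there (remove-⊆ T z∈)) }
      where
      rest-closed : ∀ {z} → z ∈ rest → f z ∈ rest
      rest-closed {z} z∈ with closed (there (remove-⊆ T z∈))
      ... | here fz≡y = ⊥-elim (remove-≢ T z∈ (trans (sym (involutive (there (remove-⊆ T z∈)))) (cong f fz≡y)))
      ... | there fz∈T = remove-∈ fz∈T λ fz≡fy →
            All.lookup y∉T (remove-⊆ T z∈)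
              (trans (sym (involutive (here refl))) (trans (cong f (sym fz≡fy)) (involutive (there (remove-⊆ T z∈)))))

    -- f y is not a fixed point, since f (f y) ≡ y ≢ f y.
    same-fixed-points : length (fixed-points f rest) ≡ length (fixed-points f T)
    same-fixed-points = same-members⇒same-length (filter⁺ _ (filter⁺ _ uT)) (filter⁺ _ uT)
      (λ z∈ → let z∈rest , fz≡z = ∈-filter⁻ (λ z → f z ≟ z) {xs = rest} z∈
              in ∈-filter⁺ (λ z → f z ≟ z) (remove-⊆ T z∈rest) fz≡z)
      (λ {z} z∈ → let z∈T , fz≡z = ∈-filter⁻ (λ z → f z ≟ z) {xs = T} z∈
                  in ∈-filter⁺ (λ z → f z ≟ z) (remove-∈ z∈T λ z≡fy →
                       fy≢y (sym (trans (sym (involutive (here refl)))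
                         (trans (cong f (sym z≡fy)) (trans fz≡z z≡fy))))) fz≡z)

  -- An involution of a finite set has as many fixed points as elements, mod 2:
  -- the non-fixed points come in pairs {y, f y}. (Induction on the length.)
  involution-parity : ∀ {f S} → Unique S → InvolutionOn f S →
    even (length S) ≡ even (length (fixed-points f S))
  involution-parity {f} {S} = go (length S) ≤-refl
    where
    go : ∀ n {S} → length S ≤ n → Unique S → InvolutionOn f S →
      even (length S) ≡ even (length (fixed-points f S))
    go n       {[]}    _ _ _ = refl
    go (suc n) {y ∷ T} (s≤s |T|≤n) (y∉T ∷ uT) inv with f y ≟ y
    ... | yes fy≡y = cong not (go n |T|≤n uT (drop-fixed-head y∉T inv fy≡y))
    ... | no fy≢y = begin
      not (even (length T))                  ≡⟨ cong (not ∘ even) (length-remove uT partner∈) ⟩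
      not (not (even (length rest)))         ≡⟨ not-involutive _ ⟩
      even (length rest)                     ≡⟨ go n |rest|≤n (filter⁺ _ uT) rest-involution ⟩
      even (length (fixed-points f rest))    ≡⟨ cong even same-fixed-points ⟩
      even (length (fixed-points f T))       ∎
      where
      open ≡-Reasoning
      open DropPair y∉T uT inv fy≢y
      |rest|≤n : length rest ≤ n
      |rest|≤n = ≤-trans (n≤1+n _) (≤-trans (≤-reflexive (sym (length-remove uT partner∈))) |T|≤n)

  another-member : ∀ {xs : List A} {a} → Unique xs → a ∈ xs → even (length xs) ≡ true →
    ∃ λ b → b ∈ xs × ¬ b ≡ a
  another-member {xs} {a} uxs a∈xs ev with remove a xs in eq
  ... | [] = ⊥-elim (true≢false (trans (sym ev) (cong even (trans (length-remove uxs a∈xs) (cong (suc ∘ length) eq)))))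
    where
    true≢false : true ≡ false → ⊥
    true≢false ()
  ... | b ∷ _ = b , remove-⊆ xs b∈ , remove-≢ xs b∈
    where
    b∈ : b ∈ remove a xs
    b∈ = subst (b ∈_) (sym eq) (here refl)

-- The operations are used through the Group bundle's notation
-- _∙_, ε, _⁻¹ so that the standard library's group lemmas apply.
module FiniteGroup {A : Set} {mul : Op₂ A} {one : A} {inv : Op₁ A}
  (isGroup : IsGroup _≡_ mul one inv) (_≟_ : DecidableEquality A)
  (elements : List A) (elements-unique : Unique elements) (∈-elements : ∀ g → g ∈ elements)
  where

  open import Data.Nat using (ℕ; zero; suc; _+_; _*_; _^_; _≤_; _<_; s≤s; z≤n; >-nonZero)
  open import Data.Nat.Properties using (≤-trans; ≤-reflexive; <-irrefl; <-≤-trans; +-identityʳ; +-suc; m^n>0)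
  open import Data.Nat.Divisibility using (_∣_; ∣⇒≤; ∣m⇒∣m*n; m∣m*n)
  open import Data.Bool using (true; false)
  open import Data.Unit using (tt)
  open import Data.Fin using (Fin; fromℕ<) renaming (_≟_ to _≟F_)
  open import Data.List using ([]; _∷_; _++_; map; length; filter; allFin)
  open import Data.List.Properties using (length-map; length-++; length-tabulate; filter-all)
  open import Data.List.Membership.Propositional using (find; lose)
  open import Data.List.Membership.Propositional.Properties
    using (∈-filter⁺; ∈-filter⁻; ∈-map⁺; ∈-map⁻; ∈-++⁺ˡ; ∈-++⁺ʳ; ∈-++⁻; ∈-allFin)
  open import Data.List.Relation.Binary.Subset.Propositional using (_⊆_)
  import Data.List.Relation.Unary.Unique.Propositional.Properties as Unique
  open import Data.List.Relation.Unary.All as All using (All; []; _∷_)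
  import Data.List.Relation.Unary.All.Properties as All
  open import Data.List.Relation.Unary.Any as Any using (Any; here; there)
  open import Data.List.Relation.Unary.AllPairs using ([]; _∷_)
  open import Data.Product using (∃; Σ; _×_; _,_; proj₁; proj₂)
  open import Data.Sum using (_⊎_; inj₁; inj₂)
  open import Data.Empty using (⊥-elim)
  open import Function using (id)
  open import Relation.Binary.PropositionalEquality
  open import Relation.Nullary using (¬_; yes; no)
  open import Relation.Unary using (Decidable)
  open Parity using (even)
  open Counting _≟_
  open ≡-Reasoning

  group : Group 0ℓ 0ℓ
  group = record { isGroup = isGroup }

  open Group group using (_∙_; ε; _⁻¹; assoc; identityˡ; identityʳ; inverseˡ; inverseʳ)
  open import Algebra.Properties.Group group
    using (∙-cancelˡ; ∙-cancelʳ; ⁻¹-involutive; ⁻¹-anti-homo-∙; ε⁻¹≈ε; inverseʳ-unique;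
           \\-leftDividesˡ; \\-leftDividesʳ; //-rightDividesˡ; //-rightDividesʳ)

  all-kept : ∀ {B : Set} (xs : List B) → filter (λ (_ : B) → yes tt) xs ≡ xs
  all-kept xs = filter-all (λ _ → yes tt) (All.universal (λ _ → tt) xs)

  length-positive : ∀ {B : Set} {x : B} {xs} → x ∈ xs → 0 < length xs
  length-positive (here _)  = s≤s z≤n
  length-positive (there _) = s≤s z≤n

  record Subgroup (P : List A) : Set where
    field
      unique    : Unique P
      ε∈        : ε ∈ P
      ∙-closed  : ∀ {x y} → x ∈ P → y ∈ P → x ∙ y ∈ P
      ⁻¹-closed : ∀ {x} → x ∈ P → x ⁻¹ ∈ P

  Normalises : A → List A → Set
  Normalises g P = ∀ {p} → p ∈ P → g ⁻¹ ∙ (p ∙ g) ∈ P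

  -- For a finite subgroup, conjugation by g maps P into P only if it maps P
  -- onto P; hence a normalising element's inverse normalises P as well.
  normalises-⁻¹ : ∀ {P} → Subgroup P → ∀ {g} → Normalises g P → ∀ {p} → p ∈ P → g ∙ (p ∙ g ⁻¹) ∈ P
  normalises-⁻¹ {P} sub {g} normal {p} p∈P
    with ∈-map⁻ conj (⊆∧length-≥⇒⊇ (Unique.map⁺ conj-injective unique) unique image⊆P
                        (≤-reflexive (sym (length-map conj P))) p∈P)
    where
    open Subgroup sub
    conj : A → A
    conj q = g ⁻¹ ∙ (q ∙ g)
    conj-injective : ∀ {x y} → conj x ≡ conj y → x ≡ y
    conj-injective eq = ∙-cancelʳ g _ _ (∙-cancelˡ (g ⁻¹) _ _ eq)
    image⊆P : map conj P ⊆ P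
    image⊆P q∈ with ∈-map⁻ conj q∈
    ... | q , q∈P , refl = normal q∈P
  ... | q , q∈P , refl = subst (_∈ P) (sym unconjugate) q∈P
    where
    unconjugate : g ∙ ((g ⁻¹ ∙ (q ∙ g)) ∙ g ⁻¹) ≡ q
    unconjugate = begin
      g ∙ ((g ⁻¹ ∙ (q ∙ g)) ∙ g ⁻¹) ≡⟨ assoc g _ _ ⟨
      (g ∙ (g ⁻¹ ∙ (q ∙ g))) ∙ g ⁻¹ ≡⟨ cong (_∙ g ⁻¹) (\\-leftDividesˡ g (q ∙ g)) ⟩
      (q ∙ g) ∙ g ⁻¹               ≡⟨ //-rightDividesʳ g q ⟩
      q                            ∎

  data Tower : List A → ℕ → Set where
    base : Tower (ε ∷ []) 0
    step : ∀ {P k} → Tower P k → (g : A) → g ∉ P → Normalises g P → g ∙ g ∈ P →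
           Tower (P ++ map (g ∙_) P) (suc k)

  tower-length : ∀ {P k} → Tower P k → length P ≡ 2 ^ k
  tower-length base = refl
  tower-length (step {P} {k} t g _ _ _) = begin
    length (P ++ map (g ∙_) P)        ≡⟨ length-++ P ⟩
    length P + length (map (g ∙_) P)  ≡⟨ cong (length P +_) (length-map (g ∙_) P) ⟩
    length P + length P               ≡⟨ cong₂ _+_ (tower-length t) (tower-length t) ⟩
    2 ^ k + 2 ^ k                     ≡⟨ cong (2 ^ k +_) (sym (+-identityʳ (2 ^ k))) ⟩
    2 ^ suc k                         ∎

  ∈-extension⁻ : ∀ {P g x} → x ∈ P ++ map (g ∙_) P → x ∈ P ⊎ ∃ λ p → p ∈ P × x ≡ g ∙ p
  ∈-extension⁻ {P} x∈ with ∈-++⁻ P x∈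
  ... | inj₁ x∈P = inj₁ x∈P
  ... | inj₂ x∈gP = inj₂ (∈-map⁻ _ x∈gP)

  ∈-extension⁺ : ∀ {P g x} p → p ∈ P → x ≡ g ∙ p → x ∈ P ++ map (g ∙_) P
  ∈-extension⁺ {P} p p∈P refl = ∈-++⁺ʳ P (∈-map⁺ _ p∈P)

  -- The identities showing that P ∪ gP is closed, when g normalises P.
  module ExtensionIdentities (g : A) where

    left-times-coset : ∀ p q → g ∙ ((g ⁻¹ ∙ (p ∙ g)) ∙ q) ≡ p ∙ (g ∙ q)
    left-times-coset p q = begin
      g ∙ ((g ⁻¹ ∙ (p ∙ g)) ∙ q)  ≡⟨ assoc g _ q ⟨
      (g ∙ (g ⁻¹ ∙ (p ∙ g))) ∙ q  ≡⟨ cong (_∙ q) (\\-leftDividesˡ g (p ∙ g)) ⟩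
      (p ∙ g) ∙ q                 ≡⟨ assoc p g q ⟩
      p ∙ (g ∙ q)                 ∎

    coset-times-coset : ∀ p q → (g ∙ g) ∙ ((g ⁻¹ ∙ (p ∙ g)) ∙ q) ≡ (g ∙ p) ∙ (g ∙ q)
    coset-times-coset p q = begin
      (g ∙ g) ∙ ((g ⁻¹ ∙ (p ∙ g)) ∙ q)  ≡⟨ assoc g g _ ⟩
      g ∙ (g ∙ ((g ⁻¹ ∙ (p ∙ g)) ∙ q))  ≡⟨ cong (g ∙_) (left-times-coset p q) ⟩
      g ∙ (p ∙ (g ∙ q))                 ≡⟨ assoc g p _ ⟨
      (g ∙ p) ∙ (g ∙ q)                 ∎

    coset-inverse : ∀ p → g ∙ ((g ∙ g) ⁻¹ ∙ (g ∙ (p ⁻¹ ∙ g ⁻¹))) ≡ (g ∙ p) ⁻¹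
    coset-inverse p = begin
      g ∙ ((g ∙ g) ⁻¹ ∙ (g ∙ (p ⁻¹ ∙ g ⁻¹)))    ≡⟨ assoc g _ _ ⟨
      (g ∙ (g ∙ g) ⁻¹) ∙ (g ∙ (p ⁻¹ ∙ g ⁻¹))    ≡⟨ cong (λ z → (g ∙ z) ∙ (g ∙ (p ⁻¹ ∙ g ⁻¹))) (⁻¹-anti-homo-∙ g g) ⟩
      (g ∙ (g ⁻¹ ∙ g ⁻¹)) ∙ (g ∙ (p ⁻¹ ∙ g ⁻¹))  ≡⟨ cong (_∙ (g ∙ (p ⁻¹ ∙ g ⁻¹))) (\\-leftDividesˡ g (g ⁻¹)) ⟩
      g ⁻¹ ∙ (g ∙ (p ⁻¹ ∙ g ⁻¹))                ≡⟨ \\-leftDividesʳ g _ ⟩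
      p ⁻¹ ∙ g ⁻¹                               ≡⟨ ⁻¹-anti-homo-∙ g p ⟨
      (g ∙ p) ⁻¹                                ∎

  tower-subgroup : ∀ {P k} → Tower P k → Subgroup P
  tower-subgroup base = record
    { unique    = [] ∷ []
    ; ε∈        = here refl
    ; ∙-closed  = λ { (here refl) (here refl) → here (identityˡ ε) }
    ; ⁻¹-closed = λ { (here refl) → here ε⁻¹≈ε } }
  tower-subgroup (step {P} t g g∉P normal g²∈P) = record
    { unique    = Unique.++⁺ unique (Unique.map⁺ (∙-cancelˡ g _ _) unique) disjoint
    ; ε∈        = ∈-++⁺ˡ ε∈
    ; ∙-closed  = closed
    ; ⁻¹-closed = inverse-closed }
    where
    open Subgroup (tower-subgroup t)
    open ExtensionIdentities g
    disjoint : ∀ {v} → ¬ (v ∈ P × v ∈ map (g ∙_) P)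
    disjoint (v∈P , v∈gP) with ∈-map⁻ _ v∈gP
    ... | p , p∈P , refl = g∉P (subst (_∈ P) (//-rightDividesʳ p g) (∙-closed v∈P (⁻¹-closed p∈P)))
    closed : ∀ {x y} → x ∈ P ++ map (g ∙_) P → y ∈ P ++ map (g ∙_) P → x ∙ y ∈ P ++ map (g ∙_) P
    closed {x} {y} x∈ y∈ with ∈-extension⁻ {P} x∈ | ∈-extension⁻ {P} y∈
    ... | inj₁ x∈P | inj₁ y∈P = ∈-++⁺ˡ (∙-closed x∈P y∈P)
    ... | inj₁ x∈P | inj₂ (q , q∈P , refl) =
          ∈-extension⁺ _ (∙-closed (normal x∈P) q∈P) (sym (left-times-coset x q))
    ... | inj₂ (p , p∈P , refl) | inj₁ y∈P = ∈-extension⁺ _ (∙-closed p∈P y∈P) (assoc g p y)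
    ... | inj₂ (p , p∈P , refl) | inj₂ (q , q∈P , refl) =
          ∈-++⁺ˡ (subst (_∈ P) (coset-times-coset p q) (∙-closed g²∈P (∙-closed (normal p∈P) q∈P)))
    inverse-closed : ∀ {x} → x ∈ P ++ map (g ∙_) P → x ⁻¹ ∈ P ++ map (g ∙_) P
    inverse-closed x∈ with ∈-extension⁻ {P} x∈
    ... | inj₁ x∈P = ∈-++⁺ˡ (⁻¹-closed x∈P)
    ... | inj₂ (p , p∈P , refl) = ∈-extension⁺ _
          (∙-closed (⁻¹-closed g²∈P) (normalises-⁻¹ (tower-subgroup t) normal (⁻¹-closed p∈P)))
          (sym (coset-inverse p))

  record ActionOn {X : Set} (act : A → X → X) (ys : List X) : Set where
    field
      points-unique : Unique ys
      act-ε         : ∀ {y} → y ∈ ys → act ε y ≡ y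
      act-∙         : ∀ g h {y} → y ∈ ys → act (g ∙ h) y ≡ act g (act h y)
      act-closed    : ∀ g {y} → y ∈ ys → act g y ∈ ys

  module FixedPoints {X : Set} (_≟X_ : DecidableEquality X)
    {act : A → X → X} {ys : List X} (action : ActionOn act ys) where

    open ActionOn action
    module CountX = Counting _≟X_

    FixedBy : List A → X → Set
    FixedBy P y = All (λ p → act p y ≡ y) P

    fixed-by? : (P : List A) → Decidable (FixedBy P)
    fixed-by? P y = All.all? (λ p → act p y ≟X y) P

    fixed-by : List A → List X
    fixed-by P = filter (fixed-by? P) ys

    fixed⁻ : ∀ {P y} → y ∈ fixed-by P → y ∈ ys × FixedBy P y
    fixed⁻ {P} = ∈-filter⁻ (fixed-by? P) {xs = ys}

    normalising-involution : ∀ {P g} → Normalises g P → g ∙ g ∈ P → CountX.InvolutionOn (act g) (fixed-by P)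
    normalising-involution {P} {g} normal g²∈P = record
      { closed = λ {y} y∈ → let y∈ys , fixed = fixed⁻ y∈ in
          ∈-filter⁺ (fixed-by? P) (act-closed g y∈ys) (All.tabulate λ {p} p∈P → begin
            act p (act g y)                   ≡⟨ act-∙ p g y∈ys ⟨
            act (p ∙ g) y                     ≡⟨ cong (λ z → act z y) (\\-leftDividesˡ g (p ∙ g)) ⟨
            act (g ∙ (g ⁻¹ ∙ (p ∙ g))) y      ≡⟨ act-∙ g _ y∈ys ⟩
            act g (act (g ⁻¹ ∙ (p ∙ g)) y)    ≡⟨ cong (act g) (All.lookup fixed (normal p∈P)) ⟩
            act g y                           ∎)
      ; involutive = λ y∈ → let y∈ys , fixed = fixed⁻ y∈ in
          trans (sym (act-∙ g g y∈ys)) (All.lookup fixed g²∈P) }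

    fixed-by-extension : ∀ {P g} → ε ∈ P →
      length (CountX.fixed-points (act g) (fixed-by P)) ≡ length (fixed-by (P ++ map (g ∙_) P))
    fixed-by-extension {P} {g} ε∈P = CountX.same-members⇒same-length
      (Unique.filter⁺ _ (Unique.filter⁺ _ points-unique)) (Unique.filter⁺ _ points-unique) to from
      where
      to : CountX.fixed-points (act g) (fixed-by P) ⊆ fixed-by (P ++ map (g ∙_) P)
      to {y} y∈ with ∈-filter⁻ (λ y → act g y ≟X y) {xs = fixed-by P} y∈
      ... | y∈Fix , gy≡y with fixed⁻ y∈Fix
      ... | y∈ys , fixed = ∈-filter⁺ (fixed-by? _) y∈ys (All.++⁺ fixed (All.map⁺ (All.tabulate λ {p} p∈P →
            trans (act-∙ g p y∈ys) (trans (cong (act g) (All.lookup fixed p∈P)) gy≡y))))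
      from : fixed-by (P ++ map (g ∙_) P) ⊆ CountX.fixed-points (act g) (fixed-by P)
      from {y} y∈ with fixed⁻ y∈
      ... | y∈ys , fixed = ∈-filter⁺ (λ y → act g y ≟X y) (∈-filter⁺ (fixed-by? P) y∈ys (All.++⁻ˡ P fixed))
            (subst (λ z → act z y ≡ y) (identityʳ g) (All.lookup (All.map⁻ (All.++⁻ʳ P fixed)) ε∈P))

    -- A 2-group fixes as many points as there are points, mod 2: passing from
    -- P to P ∪ gP, the element g acts on the points fixed by P as an
    -- involution, whose fixed points are those fixed by P ∪ gP.
    fixed-point-parity : ∀ {P k} → Tower P k → even (length ys) ≡ even (length (fixed-by P))
    fixed-point-parity base = cong even (CountX.same-members⇒same-length points-unique (Unique.filter⁺ _ points-unique)
      (λ y∈ → ∈-filter⁺ (fixed-by? _) y∈ (act-ε y∈ ∷ []))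
      (λ y∈ → proj₁ (fixed⁻ y∈)))
    fixed-point-parity (step {P} t g _ normal g²∈P) = begin
      even (length ys)                                         ≡⟨ fixed-point-parity t ⟩
      even (length (fixed-by P))                               ≡⟨ CountX.involution-parity (Unique.filter⁺ _ points-unique)
                                                                    (normalising-involution normal g²∈P) ⟩
      even (length (CountX.fixed-points (act g) (fixed-by P))) ≡⟨ cong even (fixed-by-extension (Subgroup.ε∈ (tower-subgroup t))) ⟩
      even (length (fixed-by (P ++ map (g ∙_) P)))             ∎

  -- The first member of a list satisfying a decidable predicate (d if none).
  first : ∀ {Q : A → Set} → Decidable Q → List A → A → A
  first Q? []       d = d
  first Q? (x ∷ xs) d with Q? x
  ... | yes _ = x
  ... | no  _ = first Q? xs d

  first-satisfies : ∀ {Q : A → Set} (Q? : Decidable Q) xs {d} → Q d → Q (first Q? xs d)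
  first-satisfies Q? []       Qd = Qd
  first-satisfies Q? (x ∷ xs) Qd with Q? x
  ... | yes Qx = Qx
  ... | no  _  = first-satisfies Q? xs Qd

  first-cong : ∀ {Q Q′ : A → Set} (Q? : Decidable Q) (Q′? : Decidable Q′) xs {d d′} →
    (∀ {h} → Q h → Q′ h) → (∀ {h} → Q′ h → Q h) → Any Q xs → first Q? xs d ≡ first Q′? xs d′
  first-cong Q? Q′? (x ∷ xs) to from some with Q? x | Q′? x
  ... | yes _  | yes _   = refl
  ... | yes Qx | no ¬Q′x = ⊥-elim (¬Q′x (to Qx))
  ... | no ¬Qx | yes Q′x = ⊥-elim (¬Qx (from Q′x))
  ... | no ¬Qx | no _ with some
  ...   | here Qx    = ⊥-elim (¬Qx Qx)
  ...   | there some′ = first-cong Q? Q′? xs to from some′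

  module LeftCosets {P : List A} (sub : Subgroup P) where
    open Subgroup sub
    open import Data.List.Membership.DecPropositional _≟_ using (_∈?_)
    open import Data.List.Membership.Propositional using (lose)

    SameCoset : A → A → Set
    SameCoset g h = g ⁻¹ ∙ h ∈ P

    rep : A → A
    rep g = first (λ h → g ⁻¹ ∙ h ∈? P) elements g

    same-coset-refl : ∀ g → SameCoset g g
    same-coset-refl g = subst (_∈ P) (sym (inverseˡ g)) ε∈

    rep-in-coset : ∀ g → SameCoset g (rep g)
    rep-in-coset g = first-satisfies (λ h → g ⁻¹ ∙ h ∈? P) elements (same-coset-refl g)

    coset-trans : ∀ {g g′ h} → SameCoset g g′ → SameCoset g′ h → SameCoset g h
    coset-trans {g} {g′} {h} g~g′ g′~h = subst (_∈ P) chain (∙-closed g~g′ g′~h)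
      where
      chain : (g ⁻¹ ∙ g′) ∙ (g′ ⁻¹ ∙ h) ≡ g ⁻¹ ∙ h
      chain = trans (assoc _ _ _) (cong (g ⁻¹ ∙_) (\\-leftDividesˡ g′ h))

    coset-sym : ∀ {g g′} → SameCoset g g′ → SameCoset g′ g
    coset-sym {g} {g′} g~g′ = subst (_∈ P) flip (⁻¹-closed g~g′)
      where
      flip : (g ⁻¹ ∙ g′) ⁻¹ ≡ g′ ⁻¹ ∙ g
      flip = trans (⁻¹-anti-homo-∙ (g ⁻¹) g′) (cong (g′ ⁻¹ ∙_) (⁻¹-involutive g))

    coset-translate : ∀ g {x z} → SameCoset x z → SameCoset (g ∙ x) (g ∙ z)
    coset-translate g {x} {z} x~z = subst (_∈ P) (sym cancel-g) x~z
      where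
      cancel-g : (g ∙ x) ⁻¹ ∙ (g ∙ z) ≡ x ⁻¹ ∙ z
      cancel-g = begin
        (g ∙ x) ⁻¹ ∙ (g ∙ z)      ≡⟨ cong (_∙ (g ∙ z)) (⁻¹-anti-homo-∙ g x) ⟩
        (x ⁻¹ ∙ g ⁻¹) ∙ (g ∙ z)   ≡⟨ assoc (x ⁻¹) _ _ ⟩
        x ⁻¹ ∙ (g ⁻¹ ∙ (g ∙ z))   ≡⟨ cong (x ⁻¹ ∙_) (\\-leftDividesʳ g z) ⟩
        x ⁻¹ ∙ z                  ∎

    ε-coset⁺ : ∀ {x} → x ∈ P → SameCoset ε x
    ε-coset⁺ {x} = subst (_∈ P) (sym (trans (cong (_∙ x) ε⁻¹≈ε) (identityˡ x)))

    ε-coset⁻ : ∀ {x} → SameCoset ε x → x ∈ P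
    ε-coset⁻ {x} = subst (_∈ P) (trans (cong (_∙ x) ε⁻¹≈ε) (identityˡ x))

    rep-cong : ∀ {g g′} → SameCoset g g′ → rep g ≡ rep g′
    rep-cong {g} g~g′ = first-cong _ _ elements
      (coset-trans (coset-sym g~g′)) (coset-trans g~g′)
      (lose (∈-elements g) (same-coset-refl g))

    rep-cong⁻ : ∀ {g g′} → rep g ≡ rep g′ → SameCoset g g′
    rep-cong⁻ {g} {g′} eq =
      coset-trans (subst (SameCoset g) eq (rep-in-coset g)) (coset-sym (rep-in-coset g′))

    rep-idempotent : ∀ g → rep (rep g) ≡ rep g
    rep-idempotent g = sym (rep-cong (rep-in-coset g))

    reps : List A
    reps = filter (λ g → rep g ≟ g) elements

    reps-unique : Unique reps
    reps-unique = Unique.filter⁺ _ elements-unique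

    rep∈reps : ∀ g → rep g ∈ reps
    rep∈reps g = ∈-filter⁺ (λ g → rep g ≟ g) (∈-elements (rep g)) (rep-idempotent g)

    ∈reps⇒rep≡ : ∀ {r} → r ∈ reps → rep r ≡ r
    ∈reps⇒rep≡ r∈ = proj₂ (∈-filter⁻ (λ g → rep g ≟ g) {xs = elements} r∈)

    coset-count : ∀ {S : A → Set} (S? : Decidable S) → (∀ {g p} → p ∈ P → S g → S (g ∙ p)) →
      length (filter S? elements) ≡ length (filter S? reps) * length P
    coset-count {S} S? stable = fibre-count _≟_ rep (filter S? elements) (filter S? reps) (length P)
      (Unique.filter⁺ _ elements-unique) (Unique.filter⁺ _ reps-unique) into fibre-size
      where
      into : ∀ {x} → x ∈ filter S? elements → rep x ∈ filter S? reps
      into {x} x∈ = ∈-filter⁺ S? (rep∈reps x)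
        (subst S (\\-leftDividesˡ x (rep x)) (stable (rep-in-coset x) (proj₂ (∈-filter⁻ S? {xs = elements} x∈))))
      -- The fibre over a representative r is its coset rP.
      fibre-size : ∀ {r} → r ∈ filter S? reps → length (fibre _≟_ rep r (filter S? elements)) ≡ length P
      fibre-size {r} r∈ = trans
        (same-members⇒same-length (Unique.filter⁺ _ (Unique.filter⁺ _ elements-unique))
          (Unique.map⁺ (∙-cancelˡ r _ _) unique) to from)
        (length-map (r ∙_) P)
        where
        r∈reps : r ∈ reps
        r∈reps = proj₁ (∈-filter⁻ S? {xs = reps} r∈)
        Sr : S r
        Sr = proj₂ (∈-filter⁻ S? {xs = reps} r∈)
        to : fibre _≟_ rep r (filter S? elements) ⊆ map (r ∙_) P
        to {x} x∈ = subst (_∈ map (r ∙_) P) (\\-leftDividesˡ r x)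
          (∈-map⁺ (r ∙_) (rep-cong⁻ (trans (∈reps⇒rep≡ r∈reps)
            (sym (proj₂ (∈-filter⁻ (λ x → rep x ≟ r) {xs = filter S? elements} x∈))))))
        from : map (r ∙_) P ⊆ fibre _≟_ rep r (filter S? elements)
        from x∈ with ∈-map⁻ (r ∙_) x∈
        ... | p , p∈P , refl = ∈-filter⁺ (λ x → rep x ≟ r) (∈-filter⁺ S? (∈-elements _) (stable p∈P Sr))
              (trans (sym (rep-cong (subst (_∈ P) (sym (\\-leftDividesʳ r p)) p∈P))) (∈reps⇒rep≡ r∈reps))

    lagrange : length elements ≡ length reps * length P
    lagrange = begin
      length elements                        ≡⟨ cong length (sym (all-kept elements)) ⟩
      length (filter (λ _ → yes tt) elements) ≡⟨ coset-count (λ _ → yes tt) (λ _ _ → tt) ⟩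
      length (filter (λ _ → yes tt) reps) * length P ≡⟨ cong (λ xs → length xs * length P) (all-kept reps) ⟩
      length reps * length P                 ∎

  index : ∀ {P k} → Tower P k → ℕ
  index t = length (LeftCosets.reps (tower-subgroup t))

  -- If a stage P has even index, the tower extends: P acts on its cosets by
  -- left multiplication, and the fixed cosets rP (r normalising P) are even in
  -- number; r P ↦ r⁻¹ P is an involution on them fixing P, so it fixes another
  -- coset gP, and then g ∉ P normalises P with g² ∈ P.
  module Growth {P k} (t : Tower P k) where
    open Subgroup (tower-subgroup t)
    open LeftCosets (tower-subgroup t)

    translation : ActionOn (λ h r → rep (h ∙ r)) reps
    translation = record
      { points-unique = reps-unique
      ; act-ε = λ r∈ → trans (cong rep (identityˡ _)) (∈reps⇒rep≡ r∈)
      ; act-∙ = λ g h {y} _ → trans (cong rep (assoc g h y)) (rep-cong (coset-translate g (rep-in-coset (h ∙ y))))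
      ; act-closed = λ g _ → rep∈reps _ }

    open FixedPoints _≟_ translation

    fixed⇒normalises : ∀ {r} → r ∈ fixed-by P → Normalises r P
    fixed⇒normalises {r} r∈ p∈P with fixed⁻ r∈
    ... | r∈reps , fixed = rep-cong⁻ (trans (∈reps⇒rep≡ r∈reps) (sym (All.lookup fixed p∈P)))

    ∈P⇒rep≡ : ∀ {x} → x ∈ P → rep x ≡ rep ε
    ∈P⇒rep≡ x∈P = rep-cong (coset-sym (ε-coset⁺ x∈P))

    invert : A → A
    invert r = rep (r ⁻¹)

    invert-involution : InvolutionOn invert (fixed-by P)
    invert-involution = record { closed = closed ; involutive = involutive }
      where
      closed : ∀ {r} → r ∈ fixed-by P → invert r ∈ fixed-by P
      closed {r} r∈ = ∈-filter⁺ (fixed-by? P) (rep∈reps _) (All.tabulate λ {p} p∈P → begin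
        rep (p ∙ rep (r ⁻¹))  ≡⟨ rep-cong (coset-translate p (rep-in-coset (r ⁻¹))) ⟨
        rep (p ∙ r ⁻¹)        ≡⟨ rep-cong (r⁻¹~pr⁻¹ p∈P) ⟨
        rep (r ⁻¹)            ∎)
        where
        r⁻¹~pr⁻¹ : ∀ {p} → p ∈ P → SameCoset (r ⁻¹) (p ∙ r ⁻¹)
        r⁻¹~pr⁻¹ p∈P = subst (λ z → z ∙ (_ ∙ r ⁻¹) ∈ P) (sym (⁻¹-involutive r))
          (normalises-⁻¹ (tower-subgroup t) (fixed⇒normalises r∈) p∈P)
      involutive : ∀ {r} → r ∈ fixed-by P → invert (invert r) ≡ r
      involutive {r} r∈ = trans (rep-cong s⁻¹~r) (∈reps⇒rep≡ (proj₁ (fixed⁻ r∈)))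
        where
        s : A
        s = rep (r ⁻¹)
        rs∈P : r ∙ s ∈ P
        rs∈P = subst (λ z → z ∙ s ∈ P) (⁻¹-involutive r) (rep-in-coset (r ⁻¹))
        unconjugate : r ⁻¹ ∙ ((r ∙ s) ∙ r) ≡ s ∙ r
        unconjugate = trans (cong (r ⁻¹ ∙_) (assoc r s r)) (\\-leftDividesʳ r (s ∙ r))
        s⁻¹~r : SameCoset (s ⁻¹) r
        s⁻¹~r = subst (λ z → z ∙ r ∈ P) (sym (⁻¹-involutive s))
          (subst (_∈ P) unconjugate (fixed⇒normalises r∈ rs∈P))

    grow : even (length reps) ≡ true → ∃ λ P′ → Tower P′ (suc k)
    grow even-index with another-member (Unique.filter⁺ _ (Unique.filter⁺ _ reps-unique)) r₀∈ even-fixed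
      where
      r₀ : A
      r₀ = rep ε
      r₀∈P : r₀ ∈ P
      r₀∈P = ε-coset⁻ (rep-in-coset ε)
      r₀∈ : r₀ ∈ fixed-points invert (fixed-by P)
      r₀∈ = ∈-filter⁺ (λ r → invert r ≟ r)
        (∈-filter⁺ (fixed-by? P) (rep∈reps ε) (All.tabulate λ p∈P → ∈P⇒rep≡ (∙-closed p∈P r₀∈P)))
        (∈P⇒rep≡ (⁻¹-closed r₀∈P))
      even-fixed : even (length (fixed-points invert (fixed-by P))) ≡ true
      even-fixed = trans (sym (involution-parity (Unique.filter⁺ _ reps-unique) invert-involution))
                         (trans (sym (fixed-point-parity t)) even-index)
    ... | g , g∈ , g≢r₀ = _ , step t g g∉P (fixed⇒normalises g∈fixed) g²∈P
      where
      g∈fixed : g ∈ fixed-by P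
      g∈fixed = proj₁ (∈-filter⁻ (λ r → invert r ≟ r) {xs = fixed-by P} g∈)
      invert-g : invert g ≡ g
      invert-g = proj₂ (∈-filter⁻ (λ r → invert r ≟ r) {xs = fixed-by P} g∈)
      g∈reps : g ∈ reps
      g∈reps = proj₁ (fixed⁻ g∈fixed)
      g∉P : g ∉ P
      g∉P g∈P = g≢r₀ (trans (sym (∈reps⇒rep≡ g∈reps)) (∈P⇒rep≡ g∈P))
      g²∈P : g ∙ g ∈ P
      g²∈P = subst (λ z → z ∙ g ∈ P) (⁻¹-involutive g)
        (rep-cong⁻ (trans invert-g (sym (∈reps⇒rep≡ g∈reps))))

  tower-fits : ∀ {P k} → Tower P k → 2 ^ k ≤ length elements
  tower-fits t = ≤-trans (≤-reflexive (sym (tower-length t)))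
    (⊆⇒length-≤ (Subgroup.unique (tower-subgroup t)) elements-unique (λ {x} _ → ∈-elements x))

  Sylow2 : Set
  Sylow2 = ∃ λ P → ∃ λ k → Σ (Tower P k) λ t → even (index t) ≡ false

  -- Grow the tower while the index is even; this stops before height |G|,
  -- since 2^k ≤ |G| forces k < |G|.
  sylow : Sylow2
  sylow = grow-from (length elements) base refl
    where
    grow-from : ∀ fuel {P k} (t : Tower P k) → k + fuel ≡ length elements → Sylow2
    grow-from zero {k = k} t k+0≡|G| = ⊥-elim (<-irrefl refl
      (<-≤-trans (Parity.n<2^n k) (≤-trans (tower-fits t) (≤-reflexive (trans (sym k+0≡|G|) (+-identityʳ k))))))
    grow-from (suc fuel) {P} {k} t k+fuel≡|G| with even (index t) in parity
    ... | false = P , k , t , parity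
    ... | true  = grow-from fuel (proj₂ (Growth.grow t parity)) (trans (sym (+-suc k fuel)) k+fuel≡|G|)

  square-roots : List A
  square-roots = filter (λ g → (g ∙ g) ≟ ε) elements

  -- In a group of even order there are evenly many square roots of ε: the
  -- other elements are paired off with their inverses.
  even-square-roots : even (length elements) ≡ true → even (length square-roots) ≡ true
  even-square-roots even-order = begin
    even (length square-roots)                         ≡⟨ cong even (same-members⇒same-length
                                                            (Unique.filter⁺ _ elements-unique) (Unique.filter⁺ _ elements-unique)
                                                            self-inverse⇒square-root square-root⇒self-inverse) ⟨
    even (length (fixed-points _⁻¹ elements))          ≡⟨ involution-parity elements-unique inversion ⟨
    even (length elements)                             ≡⟨ even-order ⟩
    true                                               ∎
    where
    inversion : InvolutionOn _⁻¹ elements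
    inversion = record { closed = λ _ → ∈-elements _ ; involutive = λ {g} _ → ⁻¹-involutive g }
    self-inverse⇒square-root : fixed-points _⁻¹ elements ⊆ square-roots
    self-inverse⇒square-root {g} g∈ = ∈-filter⁺ (λ g → (g ∙ g) ≟ ε) (∈-elements g)
      (trans (cong (g ∙_) (sym (proj₂ (∈-filter⁻ (λ g → (g ⁻¹) ≟ g) {xs = elements} g∈)))) (inverseʳ g))
    square-root⇒self-inverse : square-roots ⊆ fixed-points _⁻¹ elements
    square-root⇒self-inverse {g} g∈ = ∈-filter⁺ (λ g → (g ⁻¹) ≟ g) (∈-elements g)
      (sym (inverseʳ-unique g g (proj₂ (∈-filter⁻ (λ g → (g ∙ g) ≟ ε) {xs = elements} g∈))))

  conjugation : ActionOn (λ p y → p ∙ (y ∙ p ⁻¹)) square-roots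
  conjugation = record
    { points-unique = Unique.filter⁺ _ elements-unique
    ; act-ε = λ {y} _ → trans (identityˡ _) (trans (cong (y ∙_) ε⁻¹≈ε) (identityʳ y))
    ; act-∙ = λ g h {y} _ → conjugate-∙ g h y
    ; act-closed = λ p {y} y∈ → ∈-filter⁺ (λ g → (g ∙ g) ≟ ε) (∈-elements _)
        (conjugate-square-root p y (proj₂ (∈-filter⁻ (λ g → (g ∙ g) ≟ ε) {xs = elements} y∈))) }
    where
    conjugate-∙ : ∀ g h y → (g ∙ h) ∙ (y ∙ (g ∙ h) ⁻¹) ≡ g ∙ ((h ∙ (y ∙ h ⁻¹)) ∙ g ⁻¹)
    conjugate-∙ g h y = begin
      (g ∙ h) ∙ (y ∙ (g ∙ h) ⁻¹)        ≡⟨ cong (λ w → (g ∙ h) ∙ (y ∙ w)) (⁻¹-anti-homo-∙ g h) ⟩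
      (g ∙ h) ∙ (y ∙ (h ⁻¹ ∙ g ⁻¹))     ≡⟨ assoc g h _ ⟩
      g ∙ (h ∙ (y ∙ (h ⁻¹ ∙ g ⁻¹)))     ≡⟨ cong (λ w → g ∙ (h ∙ w)) (assoc y (h ⁻¹) (g ⁻¹)) ⟨
      g ∙ (h ∙ ((y ∙ h ⁻¹) ∙ g ⁻¹))     ≡⟨ cong (g ∙_) (assoc h _ (g ⁻¹)) ⟨
      g ∙ ((h ∙ (y ∙ h ⁻¹)) ∙ g ⁻¹)     ∎
    conjugate-square-root : ∀ p y → y ∙ y ≡ ε → (p ∙ (y ∙ p ⁻¹)) ∙ (p ∙ (y ∙ p ⁻¹)) ≡ ε
    conjugate-square-root p y y²≡ε = begin
      (p ∙ (y ∙ p ⁻¹)) ∙ (p ∙ (y ∙ p ⁻¹))  ≡⟨ assoc p _ _ ⟩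
      p ∙ ((y ∙ p ⁻¹) ∙ (p ∙ (y ∙ p ⁻¹)))  ≡⟨ cong (p ∙_) (assoc y (p ⁻¹) _) ⟩
      p ∙ (y ∙ (p ⁻¹ ∙ (p ∙ (y ∙ p ⁻¹))))  ≡⟨ cong (λ w → p ∙ (y ∙ w)) (\\-leftDividesʳ p _) ⟩
      p ∙ (y ∙ (y ∙ p ⁻¹))                ≡⟨ cong (p ∙_) (assoc y y (p ⁻¹)) ⟨
      p ∙ ((y ∙ y) ∙ p ⁻¹)                ≡⟨ cong (λ w → p ∙ (w ∙ p ⁻¹)) y²≡ε ⟩
      p ∙ (ε ∙ p ⁻¹)                      ≡⟨ cong (p ∙_) (identityˡ (p ⁻¹)) ⟩
      p ∙ p ⁻¹                            ≡⟨ inverseʳ p ⟩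
      ε                                   ∎

  -- In a group of even order, every 2-subgroup P centralises an involution:
  -- P fixes evenly many square roots of ε under conjugation, among them ε.
  centralised-involution : ∀ {P k} → Tower P k → even (length elements) ≡ true →
    ∃ λ z → z ∙ z ≡ ε × ¬ z ≡ ε × (∀ {p} → p ∈ P → p ∙ z ≡ z ∙ p)
  centralised-involution {P} t even-order
    with another-member (Unique.filter⁺ _ (Unique.filter⁺ _ elements-unique)) ε-fixed
           (trans (sym (fixed-point-parity t)) (even-square-roots even-order))
    where
    open FixedPoints _≟_ conjugation
    ε-fixed : ε ∈ fixed-by P
    ε-fixed = ∈-filter⁺ (fixed-by? P) (∈-filter⁺ (λ g → (g ∙ g) ≟ ε) (∈-elements ε) (identityˡ ε))
      (All.tabulate λ {p} _ → trans (cong (p ∙_) (identityˡ _)) (inverseʳ p))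
  ... | z , z∈ , z≢ε = z , z²≡ε , z≢ε , commutes
    where
    open FixedPoints _≟_ conjugation
    z∈roots : z ∈ square-roots
    z∈roots = proj₁ (fixed⁻ z∈)
    z-fixed : FixedBy P z
    z-fixed = proj₂ (fixed⁻ z∈)
    z²≡ε : z ∙ z ≡ ε
    z²≡ε = proj₂ (∈-filter⁻ (λ g → (g ∙ g) ≟ ε) {xs = elements} z∈roots)
    commutes : ∀ {p} → p ∈ P → p ∙ z ≡ z ∙ p
    commutes {p} p∈P = begin
      p ∙ z                  ≡⟨ cong (p ∙_) (//-rightDividesˡ p z) ⟨
      p ∙ ((z ∙ p ⁻¹) ∙ p)   ≡⟨ assoc p _ p ⟨
      (p ∙ (z ∙ p ⁻¹)) ∙ p   ≡⟨ cong (_∙ p) (All.lookup z-fixed p∈P) ⟩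
      z ∙ p                  ∎

  module TransitiveAction {n : ℕ} (act : A → Fin n → Fin n)
    (act-∙ : ∀ g h x → act (g ∙ h) x ≡ act g (act h x))
    (act-ε : ∀ x → act ε x ≡ x)
    (transitive : ∀ x y → ∃ λ g → act g x ≡ y)
    (faithful : ∀ g → (∀ x → act g x ≡ x) → g ≡ ε) where

    module CountFin = Counting (_≟F_ {n})

    points : List (Fin n)
    points = allFin n

    points-unique : Unique points
    points-unique = Unique.allFin⁺ n

    length-points : length points ≡ n
    length-points = length-tabulate id

    act-⁻¹ : ∀ g x → act (g ⁻¹) (act g x) ≡ x
    act-⁻¹ g x = begin
      act (g ⁻¹) (act g x)  ≡⟨ act-∙ (g ⁻¹) g x ⟨
      act (g ⁻¹ ∙ g) x      ≡⟨ cong (λ h → act h x) (inverseˡ g) ⟩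
      act ε x               ≡⟨ act-ε x ⟩
      x                     ∎

    square-ε-involutive : ∀ z → z ∙ z ≡ ε → ∀ x → act z (act z x) ≡ x
    square-ε-involutive z z²≡ε x = begin
      act z (act z x)  ≡⟨ act-∙ z z x ⟨
      act (z ∙ z) x    ≡⟨ cong (λ g → act g x) z²≡ε ⟩
      act ε x          ≡⟨ act-ε x ⟩
      x                ∎

    module Stabiliser (x : Fin n) where

      stabiliser : List A
      stabiliser = filter (λ g → act g x ≟F x) elements

      ∈-stabiliser⁻ : ∀ {h} → h ∈ stabiliser → act h x ≡ x
      ∈-stabiliser⁻ h∈ = proj₂ (∈-filter⁻ (λ g → act g x ≟F x) {xs = elements} h∈)

      -- The elements g with g⁻¹ x ≡ y form the coset G_x c⁻¹, where c x ≡ y.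
      senders : Fin n → List A
      senders y = filter (λ g → act (g ⁻¹) x ≟F y) elements

      senders-count : ∀ y → length (senders y) ≡ length stabiliser
      senders-count y = trans
        (same-members⇒same-length (Unique.filter⁺ _ elements-unique)
          (Unique.map⁺ (∙-cancelʳ (c ⁻¹) _ _) (Unique.filter⁺ _ elements-unique)) to from)
        (length-map (_∙ c ⁻¹) stabiliser)
        where
        c : A
        c = proj₁ (transitive x y)
        cx≡y : act c x ≡ y
        cx≡y = proj₂ (transitive x y)
        to : senders y ⊆ map (_∙ c ⁻¹) stabiliser
        to {g} g∈ = subst (_∈ map (_∙ c ⁻¹) stabiliser) (//-rightDividesʳ c g)
          (∈-map⁺ (_∙ c ⁻¹) (∈-filter⁺ (λ g → act g x ≟F x) (∈-elements _) (begin
            act (g ∙ c) x                ≡⟨ act-∙ g c x ⟩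
            act g (act c x)              ≡⟨ cong (act g) (trans cx≡y (sym g⁻¹x≡y)) ⟩
            act g (act (g ⁻¹) x)         ≡⟨ cong (λ h → act h (act (g ⁻¹) x)) (⁻¹-involutive g) ⟨
            act (g ⁻¹ ⁻¹) (act (g ⁻¹) x) ≡⟨ act-⁻¹ (g ⁻¹) x ⟩
            x                            ∎)))
          where
          g⁻¹x≡y : act (g ⁻¹) x ≡ y
          g⁻¹x≡y = proj₂ (∈-filter⁻ (λ g → act (g ⁻¹) x ≟F y) {xs = elements} g∈)
        from : map (_∙ c ⁻¹) stabiliser ⊆ senders y
        from g∈ with ∈-map⁻ (_∙ c ⁻¹) g∈
        ... | h , h∈ , refl = ∈-filter⁺ (λ g → act (g ⁻¹) x ≟F y) (∈-elements _) (begin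
          act ((h ∙ c ⁻¹) ⁻¹) x          ≡⟨ cong (λ g → act g x) (trans (⁻¹-anti-homo-∙ h (c ⁻¹)) (cong (_∙ h ⁻¹) (⁻¹-involutive c))) ⟩
          act (c ∙ h ⁻¹) x               ≡⟨ act-∙ c (h ⁻¹) x ⟩
          act c (act (h ⁻¹) x)           ≡⟨ cong (λ z → act c (act (h ⁻¹) z)) (∈-stabiliser⁻ h∈) ⟨
          act c (act (h ⁻¹) (act h x))   ≡⟨ cong (act c) (act-⁻¹ h x) ⟩
          act c x                        ≡⟨ cx≡y ⟩
          y                              ∎)

      orbit-count : ∀ {Q : Fin n → Set} (Q? : Decidable Q) →
        length (filter (λ g → Q? (act (g ⁻¹) x)) elements) ≡ length (filter Q? points) * length stabiliser
      orbit-count {Q} Q? = fibre-count _≟F_ (λ g → act (g ⁻¹) x) _ _ _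
        (Unique.filter⁺ _ elements-unique) (Unique.filter⁺ _ points-unique)
        (λ g∈ → ∈-filter⁺ Q? (∈-allFin _) (proj₂ (∈-filter⁻ (λ g → Q? (act (g ⁻¹) x)) {xs = elements} g∈)))
        fibre-size
        where
        fibre-size : ∀ {y} → y ∈ filter Q? points →
          length (fibre _≟F_ (λ g → act (g ⁻¹) x) y (filter (λ g → Q? (act (g ⁻¹) x)) elements)) ≡ length stabiliser
        fibre-size {y} y∈ = trans
          (same-members⇒same-length (Unique.filter⁺ _ (Unique.filter⁺ _ elements-unique)) (Unique.filter⁺ _ elements-unique)
            (λ g∈ → let _ , g⁻¹x≡y = ∈-filter⁻ (λ g → act (g ⁻¹) x ≟F y) {xs = filter (λ g → Q? (act (g ⁻¹) x)) elements} g∈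
                    in ∈-filter⁺ (λ g → act (g ⁻¹) x ≟F y) (∈-elements _) g⁻¹x≡y)
            (λ g∈ → let _ , g⁻¹x≡y = ∈-filter⁻ (λ g → act (g ⁻¹) x ≟F y) {xs = elements} g∈
                    in ∈-filter⁺ (λ g → act (g ⁻¹) x ≟F y)
                         (∈-filter⁺ (λ g → Q? (act (g ⁻¹) x)) (∈-elements _) (subst Q (sym g⁻¹x≡y) Qy)) g⁻¹x≡y))
          (senders-count y)
          where
          Qy : Q y
          Qy = proj₂ (∈-filter⁻ Q? {xs = points} y∈)

      orbit-stabiliser : length elements ≡ n * length stabiliser
      orbit-stabiliser = begin
        length elements  ≡⟨ cong length (sym (all-kept elements)) ⟩
        length (filter (λ g → (λ _ → yes tt) (act (g ⁻¹) x)) elements)  ≡⟨ orbit-count (λ _ → yes tt) ⟩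
        length (filter (λ _ → yes tt) points) * length stabiliser  ≡⟨ cong (λ ys → length ys * length stabiliser) (all-kept points) ⟩
        length points * length stabiliser  ≡⟨ cong (_* length stabiliser) length-points ⟩
        n * length stabiliser  ∎

    module Orbit {P : List A} (sub : Subgroup P) (x : Fin n) where
      open Subgroup sub

      InOrbit : Fin n → Set
      InOrbit y = Any (λ p → act p x ≡ y) P

      in-orbit? : Decidable InOrbit
      in-orbit? y = Any.any? (λ p → act p x ≟F y) P

      orbit : List (Fin n)
      orbit = filter in-orbit? points

      orbit-unique : Unique orbit
      orbit-unique = Unique.filter⁺ _ points-unique

      x∈orbit : x ∈ orbit
      x∈orbit = ∈-filter⁺ in-orbit? (∈-allFin x) (lose ε∈ (act-ε x))

      stable : ∀ {g p} → p ∈ P → InOrbit (act (g ⁻¹) x) → InOrbit (act ((g ∙ p) ⁻¹) x)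
      stable {g} {p} p∈P q-orbit with find q-orbit
      ... | q , q∈P , qx≡g⁻¹x = lose (∙-closed (⁻¹-closed p∈P) q∈P) (begin
        act (p ⁻¹ ∙ q) x          ≡⟨ act-∙ (p ⁻¹) q x ⟩
        act (p ⁻¹) (act q x)      ≡⟨ cong (act (p ⁻¹)) qx≡g⁻¹x ⟩
        act (p ⁻¹) (act (g ⁻¹) x) ≡⟨ act-∙ (p ⁻¹) (g ⁻¹) x ⟨
        act (p ⁻¹ ∙ g ⁻¹) x       ≡⟨ cong (λ h → act h x) (⁻¹-anti-homo-∙ g p) ⟨
        act ((g ∙ p) ⁻¹) x        ∎)

    -- If n = 2^a, the orbits of a Sylow 2-subgroup P have size divisible by
    -- 2^a: count {g : g⁻¹ x ∈ Px} once by cosets of P and once by orbit–stabiliser.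
    sylow-orbit-divisible : ∀ {a P k} (t : Tower P k) → even (index t) ≡ false → n ≡ 2 ^ a →
      ∀ x → 2 ^ a ∣ length (Orbit.orbit (tower-subgroup t) x)
    sylow-orbit-divisible {a} {P} {k} t odd-index n≡2^a x =
      Parity.two-part-divides {a} {k} {index t} {length stabiliser} {length orbit}
        {length (filter S? reps)} odd-index
        (begin
          index t * 2 ^ k            ≡⟨ cong (index t *_) (tower-length t) ⟨
          index t * length P         ≡⟨ lagrange ⟨
          length elements            ≡⟨ orbit-stabiliser ⟩
          n * length stabiliser      ≡⟨ cong (_* length stabiliser) n≡2^a ⟩
          2 ^ a * length stabiliser  ∎)
        (begin
          length (filter S? reps) * 2 ^ k     ≡⟨ cong (length (filter S? reps) *_) (tower-length t) ⟨
          length (filter S? reps) * length P  ≡⟨ coset-count S? stable ⟨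
          length (filter S? elements)         ≡⟨ orbit-count in-orbit? ⟩
          length orbit * length stabiliser    ∎)
      where
      open LeftCosets (tower-subgroup t)
      open Stabiliser x
      open Orbit (tower-subgroup t) x
      S? : Decidable (λ g → InOrbit (act (g ⁻¹) x))
      S? g = in-orbit? (act (g ⁻¹) x)

    -- Hence, if n = 2^a, a Sylow 2-subgroup is transitive: each orbit has at
    -- least 2^a = n of the n points.
    sylow-transitive : ∀ {a P k} (t : Tower P k) → even (index t) ≡ false → n ≡ 2 ^ a →
      ∀ x y → ∃ λ p → p ∈ P × act p x ≡ y
    sylow-transitive {a} t odd-index n≡2^a x y =
      find (proj₂ (∈-filter⁻ in-orbit? {xs = points} (CountFin.⊆∧length-≥⇒⊇ orbit-unique points-unique
        (λ {z} _ → ∈-allFin z) points≤orbit (∈-allFin y))))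
      where
      open Orbit (tower-subgroup t) x
      points≤orbit : length points ≤ length orbit
      points≤orbit = ≤-trans (≤-reflexive (trans length-points n≡2^a))
        (∣⇒≤ {{>-nonZero (length-positive x∈orbit)}} (sylow-orbit-divisible {a} t odd-index n≡2^a x))

    -- An element commuting with a transitive subgroup and fixing one point fixes
    -- all points; so by faithfulness, if it is not ε it moves every point.
    commuting-moves-all : ∀ {P} → (∀ x y → ∃ λ p → p ∈ P × act p x ≡ y) →
      ∀ {z} → ¬ z ≡ ε → (∀ {p} → p ∈ P → p ∙ z ≡ z ∙ p) → ∀ x → ¬ act z x ≡ x
    commuting-moves-all P-transitive {z} z≢ε commutes x zx≡x = z≢ε (faithful z λ y →
      let p , p∈P , px≡y = P-transitive x y in begin
        act z y             ≡⟨ cong (act z) px≡y ⟨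
        act z (act p x)     ≡⟨ act-∙ z p x ⟨
        act (z ∙ p) x       ≡⟨ cong (λ g → act g x) (commutes p∈P) ⟨
        act (p ∙ z) x       ≡⟨ act-∙ p z x ⟩
        act p (act z x)     ≡⟨ cong (act p) zx≡x ⟩
        act p x             ≡⟨ px≡y ⟩
        y                   ∎)

    -- The main group-theoretic fact: if n = 2^(a+1), some involution moves
    -- every point. It centralises a Sylow 2-subgroup, which is transitive.
    fixed-point-free-involution : ∀ a → n ≡ 2 ^ suc a → ∃ λ z → z ∙ z ≡ ε × ∀ x → ¬ act z x ≡ x
    fixed-point-free-involution a n≡2^a+1 with sylow
    ... | P , k , t , odd-index with centralised-involution t even-order
      where
      x₀ : Fin n
      x₀ = fromℕ< (subst (0 <_) (sym n≡2^a+1) (m^n>0 2 (suc a)))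
      -- |G| = n · |G_x₀| with n even.
      even-order : even (length elements) ≡ true
      even-order = Parity.2∣⇒even (subst (2 ∣_) (sym (trans orbit-stabiliser (cong (_* length stabiliser) n≡2^a+1)))
        (∣m⇒∣m*n (length stabiliser) (m∣m*n {2} (2 ^ a))))
        where open Stabiliser x₀
    ... | z , z²≡ε , z≢ε , commutes =
      z , z²≡ε , commuting-moves-all (sylow-transitive {suc a} t odd-index n≡2^a+1) z≢ε commutes

preimage : {n : ℕ} → (Fin n → Fin n) → Subset n → Subset n
preimage τ L = tabulate (λ i → lookup L (τ i))

-- The mirror strategy: if τ is a fixed-point-free involution of the board
-- mapping lines to lines, Player II answers each move x by τ x. The position
-- then stays symmetric (τ swaps the two players' points), so whenever Player
-- II's answer completes a line L, Player I's move had completed the line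
-- preimage τ L before it.
module MirrorStrategy {n : ℕ} (G : AvoidanceGame n) (τ : Fin n → Fin n)
  (τ-involutive : ∀ x → τ (τ x) ≡ x) (τ-moves-all : ∀ x → ¬ τ x ≡ x)
  (τ-preserves-lines : ∀ L → L ∈ lines G → preimage τ L ∈ lines G) where

  open import Data.Vec.Properties using (lookup∘tabulate; []=⇒lookup; lookup⇒[]=)
  open import Data.List.Membership.Propositional using (find; lose)
  open import Data.Maybe using (Maybe; just; nothing)
  open import Data.Product using (_,_)
  open import Data.Sum using (inj₁; inj₂)
  open import Data.Empty using (⊥-elim)
  open import Relation.Binary.PropositionalEquality
  open import Relation.Nullary using (Dec; yes; no)

  opponent : Maybe Player → Maybe Player
  opponent nothing   = nothing
  opponent (just I)  = just II
  opponent (just II) = just I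

  Symmetric : Position n → Set
  Symmetric s = ∀ y → s (τ y) ≡ opponent (s y)

  claim-here : ∀ (s : Position n) x p → claim s x p x ≡ just p
  claim-here s x p with x ≟F x
  ... | yes _  = refl
  ... | no x≢x = ⊥-elim (x≢x refl)

  claim-elsewhere : ∀ (s : Position n) x p {y} → ¬ y ≡ x → claim s x p y ≡ s y
  claim-elsewhere s x p {y} y≢x with y ≟F x
  ... | yes y≡x = ⊥-elim (y≢x y≡x)
  ... | no _    = refl

  τ-injective : ∀ {x y} → τ x ≡ τ y → x ≡ y
  τ-injective {x} {y} τx≡τy = trans (sym (τ-involutive x)) (trans (cong τ τx≡τy) (τ-involutive y))

  mirror-move : Position n → Fin n → Position n
  mirror-move s x = claim (claim s x I) (τ x) II

  I-at-x : ∀ s x → mirror-move s x x ≡ just I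
  I-at-x s x = trans (claim-elsewhere (claim s x I) (τ x) II (λ x≡τx → τ-moves-all x (sym x≡τx))) (claim-here s x I)

  II-at-τx : ∀ s x → mirror-move s x (τ x) ≡ just II
  II-at-τx s x = claim-here (claim s x I) (τ x) II

  mirror-symmetric : ∀ {s} x → Symmetric s → Symmetric (mirror-move s x)
  mirror-symmetric {s} x symmetric y = by-cases (y ≟F x) (y ≟F τ x)
    where
    open ≡-Reasoning
    by-cases : Dec (y ≡ x) → Dec (y ≡ τ x) → mirror-move s x (τ y) ≡ opponent (mirror-move s x y)
    by-cases (yes refl) _          = trans (II-at-τx s y) (cong opponent (sym (I-at-x s y)))
    by-cases (no _)     (yes refl) = trans (cong (mirror-move s x) (τ-involutive x))
                                       (trans (I-at-x s x) (cong opponent (sym (II-at-τx s x))))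
    by-cases (no y≢x)   (no y≢τx)  = begin
      mirror-move s x (τ y)          ≡⟨ claim-elsewhere (claim s x I) (τ x) II (λ τy≡τx → y≢x (τ-injective τy≡τx)) ⟩
      claim s x I (τ y)              ≡⟨ claim-elsewhere s x I (λ τy≡x → y≢τx (trans (sym (τ-involutive y)) (cong τ τy≡x))) ⟩
      s (τ y)                        ≡⟨ symmetric y ⟩
      opponent (s y)                 ≡⟨ cong opponent (claim-elsewhere s x I y≢x) ⟨
      opponent (claim s x I y)       ≡⟨ cong opponent (claim-elsewhere (claim s x I) (τ x) II y≢τx) ⟨
      opponent (mirror-move s x y)   ∎

  opponent≡II : ∀ {m} → opponent m ≡ just II → m ≡ just I
  opponent≡II {just I} _ = refl

  I-before-answer : ∀ s x {z} → mirror-move s x z ≡ just I → claim s x I z ≡ just I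
  I-before-answer s x {z} I-at-z = by-cases (z ≟F τ x)
    where
    by-cases : Dec (z ≡ τ x) → claim s x I z ≡ just I
    by-cases (yes refl) with trans (sym (II-at-τx s x)) I-at-z
    ... | ()
    by-cases (no z≢τx) = trans (sym (claim-elsewhere (claim s x I) (τ x) II z≢τx)) I-at-z

  mirror-completion : ∀ {s} x → Symmetric (mirror-move s x) →
    Completed G (mirror-move s x) II → Completed G (claim s x I) I
  mirror-completion {s} x symmetric II-completes with find II-completes
  ... | L , L∈lines , L-claimed = lose (τ-preserves-lines L L∈lines) λ z z∈ →
    I-before-answer s x (opponent≡II (trans (sym (symmetric z)) (L-claimed (τ z) (τz∈L z z∈))))
    where
    τz∈L : ∀ z → z ∈ₛ preimage τ L → τ z ∈ₛ L
    τz∈L z z∈ = lookup⇒[]= (τ z) L (trans (sym (lookup∘tabulate (λ i → lookup L (τ i)) z)) ([]=⇒lookup z∈))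

  no-forced-win : ∀ {s} → Symmetric s → ¬ IWinsFrom G s I
  no-forced-win {s} symmetric (moveI x x-free no-line (moveII _ answers))
    with answers (τ x) τx-free
    where
    τx-free : claim s x I (τ x) ≡ nothing
    τx-free = trans (claim-elsewhere s x I (τ-moves-all x)) (trans (symmetric x) (cong opponent x-free))
  ... | inj₁ II-completes = no-line (mirror-completion x (mirror-symmetric x symmetric) II-completes)
  ... | inj₂ I-wins       = no-forced-win (mirror-symmetric x symmetric) I-wins

  mirror-strategy : ¬ PlayerIWin G
  mirror-strategy = no-forced-win (λ _ → refl)

-- The automorphism group of a game, as an explicit finite group: an
-- automorphism is a pair of mutually inverse lookup tables (maps of the board
-- stored as vectors) both mapping lines to lines by preimage. Tables can be
-- enumerated and compared, so the group has a duplicate-free list of elements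
-- and decidable equality.
module AutomorphismGroup {n : ℕ} (G : AvoidanceGame n) where

  open import Algebra.Structures using (IsGroup)
  open import Data.Bool.Properties using (T-irrelevant)
  open import Data.Fin using (Fin) renaming (_≟_ to _≟F_)
  import Data.Fin.Properties as Fin
  open import Data.Fin.Permutation using (_⟨$⟩ʳ_; _⟨$⟩ˡ_; inverseˡ; inverseʳ)
  open import Data.Vec using (Vec; []; _∷_; tabulate; lookup)
  open import Data.Vec.Properties using (lookup∘tabulate; tabulate∘lookup; tabulate-cong)
  import Data.Vec.Properties as Vec
  import Data.Bool as Bool
  open import Data.List using (List; []; _∷_; concatMap; map; cartesianProduct; allFin; deduplicate)
  open import Data.List.Membership.Propositional using (_∈_; lose)
  open import Data.List.Membership.Propositional.Properties
    using (∈-concatMap⁺; ∈-map⁺; ∈-allFin; ∈-cartesianProduct⁺; ∈-deduplicate⁺)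
  open import Data.List.Membership.DecPropositional using () renaming (_∈?_ to member?)
  open import Data.List.Relation.Unary.Unique.Propositional using (Unique)
  open import Data.List.Relation.Unary.Unique.DecPropositional.Properties using (deduplicate-!)
  open import Data.List.Relation.Unary.All as All using (All)
  open import Data.List.Relation.Unary.Any using (here; there)
  open import Data.Product using (Σ; ∃; _×_; _,_; proj₁; proj₂)
  import Data.Product.Properties as Product
  open import Data.Empty using (⊥-elim)
  open import Function using (id)
  open import Relation.Binary.PropositionalEquality
  open import Relation.Nullary using (Dec; yes; no)
  open import Relation.Nullary.Decidable using (True; toWitness; fromWitness; _×-dec_)

  Table : Set
  Table = Vec (Fin n) n

  infixr 9 _⊚_
  _⊚_ : Table → Table → Table
  v ⊚ u = tabulate (λ i → lookup v (lookup u i))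

  identity-table : Table
  identity-table = tabulate id

  lookup-⊚ : ∀ v u i → lookup (v ⊚ u) i ≡ lookup v (lookup u i)
  lookup-⊚ v u = lookup∘tabulate _

  lookup-identity : ∀ i → lookup identity-table i ≡ i
  lookup-identity = lookup∘tabulate id

  table-ext : ∀ {m} {X : Set} {v u : Vec X m} → (∀ i → lookup v i ≡ lookup u i) → v ≡ u
  table-ext {v = v} {u} same = trans (sym (tabulate∘lookup v)) (trans (tabulate-cong same) (tabulate∘lookup u))

  preimage-⊚ : ∀ v u L → preimage (lookup (v ⊚ u)) L ≡ preimage (lookup u) (preimage (lookup v) L)
  preimage-⊚ v u L = tabulate-cong λ i →
    trans (cong (lookup L) (lookup-⊚ v u i)) (sym (lookup∘tabulate _ (lookup u i)))

  preimage-identity : ∀ L → preimage (lookup identity-table) L ≡ L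
  preimage-identity L = table-ext λ i → trans (lookup∘tabulate _ i) (cong (lookup L) (lookup-identity i))

  PreservesLines : Table → Set
  PreservesLines v = All (λ L → preimage (lookup v) L ∈ lines G) (lines G)

  preserves-lines? : ∀ v → Dec (PreservesLines v)
  preserves-lines? v = All.all? (λ L → member? (Vec.≡-dec Bool._≟_) (preimage (lookup v) L) (lines G)) (lines G)

  Inverses : Table → Table → Set
  Inverses v w = (∀ i → lookup w (lookup v i) ≡ i) × (∀ i → lookup v (lookup w i) ≡ i)

  inverses? : ∀ v w → Dec (Inverses v w)
  inverses? v w = Fin.all? (λ i → lookup w (lookup v i) ≟F i) ×-dec Fin.all? (λ i → lookup v (lookup w i) ≟F i)

  AutomorphismPair : Table → Table → Set
  AutomorphismPair v w = Inverses v w × PreservesLines v × PreservesLines w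

  automorphism-pair? : ∀ v w → Dec (AutomorphismPair v w)
  automorphism-pair? v w = inverses? v w ×-dec preserves-lines? v ×-dec preserves-lines? w

  -- The witness is a proof of True, which is proof-irrelevant.
  Aut : Set
  Aut = Σ (Table × Table) λ (v , w) → True (automorphism-pair? v w)

  forward backward : Aut → Table
  forward  a = proj₁ (proj₁ a)
  backward a = proj₂ (proj₁ a)

  automorphism-pair : (a : Aut) → AutomorphismPair (forward a) (backward a)
  automorphism-pair a = toWitness (proj₂ a)

  mk-aut : ∀ v w → AutomorphismPair v w → Aut
  mk-aut v w pair = (v , w) , fromWitness pair

  aut-≡ : ∀ {a b : Aut} → proj₁ a ≡ proj₁ b → a ≡ b
  aut-≡ {p , t} {.p , t′} refl = cong (p ,_) (T-irrelevant t t′)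

  aut-ext : ∀ {a b : Aut} → (∀ i → lookup (forward a) i ≡ lookup (forward b) i) →
    (∀ i → lookup (backward a) i ≡ lookup (backward b) i) → a ≡ b
  aut-ext same-forward same-backward = aut-≡ (cong₂ _,_ (table-ext same-forward) (table-ext same-backward))

  inverses-⊚ : ∀ {v w u x} → Inverses v w → Inverses u x → Inverses (v ⊚ u) (x ⊚ w)
  inverses-⊚ {v} {w} {u} {x} (wv , vw) (xu , ux) = back-forth , forth-back
    where
    back-forth : ∀ i → lookup (x ⊚ w) (lookup (v ⊚ u) i) ≡ i
    back-forth i = begin
      lookup (x ⊚ w) (lookup (v ⊚ u) i)          ≡⟨ lookup-⊚ x w _ ⟩
      lookup x (lookup w (lookup (v ⊚ u) i))     ≡⟨ cong (λ j → lookup x (lookup w j)) (lookup-⊚ v u i) ⟩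
      lookup x (lookup w (lookup v (lookup u i))) ≡⟨ cong (lookup x) (wv (lookup u i)) ⟩
      lookup x (lookup u i)                      ≡⟨ xu i ⟩
      i                                          ∎
      where open ≡-Reasoning
    forth-back : ∀ i → lookup (v ⊚ u) (lookup (x ⊚ w) i) ≡ i
    forth-back i = begin
      lookup (v ⊚ u) (lookup (x ⊚ w) i)          ≡⟨ lookup-⊚ v u _ ⟩
      lookup v (lookup u (lookup (x ⊚ w) i))     ≡⟨ cong (λ j → lookup v (lookup u j)) (lookup-⊚ x w i) ⟩
      lookup v (lookup u (lookup x (lookup w i))) ≡⟨ cong (lookup v) (ux (lookup w i)) ⟩
      lookup v (lookup w i)                      ≡⟨ vw i ⟩
      i                                          ∎
      where open ≡-Reasoning

  preserves-⊚ : ∀ {v u} → PreservesLines v → PreservesLines u → PreservesLines (v ⊚ u)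
  preserves-⊚ {v} {u} v-preserves u-preserves = All.tabulate λ {L} L∈ →
    subst (_∈ lines G) (sym (preimage-⊚ v u L)) (All.lookup u-preserves (All.lookup v-preserves L∈))

  preserves-identity : PreservesLines identity-table
  preserves-identity = All.tabulate λ {L} L∈ → subst (_∈ lines G) (sym (preimage-identity L)) L∈

  _·_ : Aut → Aut → Aut
  a · b = mk-aut (forward a ⊚ forward b) (backward b ⊚ backward a)
    ( inverses-⊚ {forward a} {backward a} {forward b} {backward b} (proj₁ (automorphism-pair a)) (proj₁ (automorphism-pair b))
    , preserves-⊚ {forward a} {forward b} (proj₁ (proj₂ (automorphism-pair a))) (proj₁ (proj₂ (automorphism-pair b)))
    , preserves-⊚ {backward b} {backward a} (proj₂ (proj₂ (automorphism-pair b))) (proj₂ (proj₂ (automorphism-pair a))) )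

  e : Aut
  e = mk-aut identity-table identity-table
    ( ((λ i → trans (lookup-identity _) (lookup-identity i)) , (λ i → trans (lookup-identity _) (lookup-identity i)))
    , preserves-identity , preserves-identity )

  inv : Aut → Aut
  inv a = mk-aut (backward a) (forward a)
    ((proj₂ inverses , proj₁ inverses) , proj₂ (proj₂ (automorphism-pair a)) , proj₁ (proj₂ (automorphism-pair a)))
    where
    inverses : Inverses (forward a) (backward a)
    inverses = proj₁ (automorphism-pair a)

  ·-assoc : ∀ a b c → (a · b) · c ≡ a · (b · c)
  ·-assoc a b c = aut-ext (λ i → ⊚-assoc (forward a) (forward b) (forward c) i)
                          (λ i → sym (⊚-assoc (backward c) (backward b) (backward a) i))
    where
    ⊚-assoc : ∀ v u x i → lookup ((v ⊚ u) ⊚ x) i ≡ lookup (v ⊚ (u ⊚ x)) i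
    ⊚-assoc v u x i = begin
      lookup ((v ⊚ u) ⊚ x) i              ≡⟨ lookup-⊚ (v ⊚ u) x i ⟩
      lookup (v ⊚ u) (lookup x i)         ≡⟨ lookup-⊚ v u _ ⟩
      lookup v (lookup u (lookup x i))    ≡⟨ cong (lookup v) (lookup-⊚ u x i) ⟨
      lookup v (lookup (u ⊚ x) i)         ≡⟨ lookup-⊚ v (u ⊚ x) i ⟨
      lookup (v ⊚ (u ⊚ x)) i              ∎
      where open ≡-Reasoning

  ·-identityˡ : ∀ a → e · a ≡ a
  ·-identityˡ a = aut-ext (λ i → trans (lookup-⊚ identity-table (forward a) i) (lookup-identity _))
                          (λ i → trans (lookup-⊚ (backward a) identity-table i) (cong (lookup (backward a)) (lookup-identity i)))

  ·-identityʳ : ∀ a → a · e ≡ a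
  ·-identityʳ a = aut-ext (λ i → trans (lookup-⊚ (forward a) identity-table i) (cong (lookup (forward a)) (lookup-identity i)))
                          (λ i → trans (lookup-⊚ identity-table (backward a) i) (lookup-identity _))

  ·-inverseˡ : ∀ a → inv a · a ≡ e
  ·-inverseˡ a = aut-ext back-forth back-forth
    where
    back-forth : ∀ i → lookup (backward a ⊚ forward a) i ≡ lookup identity-table i
    back-forth i = trans (lookup-⊚ (backward a) (forward a) i)
                         (trans (proj₁ (proj₁ (automorphism-pair a)) i) (sym (lookup-identity i)))

  ·-inverseʳ : ∀ a → a · inv a ≡ e
  ·-inverseʳ a = aut-ext forth-back forth-back
    where
    forth-back : ∀ i → lookup (forward a ⊚ backward a) i ≡ lookup identity-table i
    forth-back i = trans (lookup-⊚ (forward a) (backward a) i)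
                         (trans (proj₂ (proj₁ (automorphism-pair a)) i) (sym (lookup-identity i)))

  isGroup : IsGroup _≡_ _·_ e inv
  isGroup = record
    { isMonoid = record
      { isSemigroup = record
        { isMagma = record { isEquivalence = isEquivalence ; ∙-cong = cong₂ _·_ }
        ; assoc = ·-assoc }
      ; identity = ·-identityˡ , ·-identityʳ }
    ; inverse = ·-inverseˡ , ·-inverseʳ
    ; ⁻¹-cong = cong inv }

  _≟_ : (a b : Aut) → Dec (a ≡ b)
  a ≟ b with Product.≡-dec (Vec.≡-dec _≟F_) (Vec.≡-dec _≟F_) (proj₁ a) (proj₁ b)
  ... | yes same = yes (aut-≡ same)
  ... | no  diff = no λ a≡b → diff (cong proj₁ a≡b)

  all-tables : ∀ m → List (Vec (Fin n) m)
  all-tables ℕ.zero    = [] ∷ []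
  all-tables (ℕ.suc m) = concatMap (λ x → map (x ∷_) (all-tables m)) (allFin n)

  ∈-all-tables : ∀ {m} (v : Vec (Fin n) m) → v ∈ all-tables m
  ∈-all-tables []      = here refl
  ∈-all-tables (x ∷ v) = ∈-concatMap⁺ (λ x → map (x ∷_) (all-tables _))
    (lose (∈-allFin x) (∈-map⁺ (x ∷_) (∈-all-tables v)))

  automorphisms-among : List (Table × Table) → List Aut
  automorphisms-among []             = []
  automorphisms-among (p ∷ ps) with automorphism-pair? (proj₁ p) (proj₂ p)
  ... | yes pair = mk-aut (proj₁ p) (proj₂ p) pair ∷ automorphisms-among ps
  ... | no  _    = automorphisms-among ps

  ∈-automorphisms-among : (a : Aut) {ps : List (Table × Table)} → proj₁ a ∈ ps → a ∈ automorphisms-among ps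
  ∈-automorphisms-among a {p ∷ ps} (here refl) with automorphism-pair? (proj₁ p) (proj₂ p)
  ... | yes _       = here (aut-≡ refl)
  ... | no  ¬pair   = ⊥-elim (¬pair (automorphism-pair a))
  ∈-automorphisms-among a {p ∷ ps} (there a∈) with automorphism-pair? (proj₁ p) (proj₂ p)
  ... | yes _ = there (∈-automorphisms-among a a∈)
  ... | no  _ = ∈-automorphisms-among a a∈

  elements : List Aut
  elements = deduplicate _≟_ (automorphisms-among (cartesianProduct (all-tables n) (all-tables n)))

  elements-unique : Unique elements
  elements-unique = deduplicate-! _≟_ _

  ∈-elements : ∀ a → a ∈ elements
  ∈-elements a = ∈-deduplicate⁺ _≟_ (∈-automorphisms-among a
    (∈-cartesianProduct⁺ (∈-all-tables (forward a)) (∈-all-tables (backward a))))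

  act : Aut → Fin n → Fin n
  act a = lookup (forward a)

  act-∙ : ∀ a b x → act (a · b) x ≡ act a (act b x)
  act-∙ a b = lookup-⊚ (forward a) (forward b)

  act-ε : ∀ x → act e x ≡ x
  act-ε = lookup-identity

  -- Only the identity fixes every point (its inverse table is then the identity too).
  faithful : ∀ a → (∀ x → act a x ≡ x) → a ≡ e
  faithful a fixes = aut-ext (λ i → trans (fixes i) (sym (lookup-identity i)))
    (λ i → trans (cong (lookup (backward a)) (sym (fixes i)))
                 (trans (proj₁ (proj₁ (automorphism-pair a)) i) (sym (lookup-identity i))))

  act-preserves-lines : ∀ a L → L ∈ lines G → preimage (act a) L ∈ lines G
  act-preserves-lines a L = All.lookup (proj₁ (proj₂ (automorphism-pair a)))

  from-permutation : ∀ σ → IsAutomorphism G σ → Aut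
  from-permutation σ (maps-lines , onto-lines) = mk-aut v w ((wv , vw) , v-preserves , w-preserves)
    where
    v w : Table
    v = tabulate (σ ⟨$⟩ˡ_)
    w = tabulate (σ ⟨$⟩ʳ_)
    wv : ∀ i → lookup w (lookup v i) ≡ i
    wv i = trans (lookup∘tabulate (σ ⟨$⟩ʳ_) _) (trans (cong (σ ⟨$⟩ʳ_) (lookup∘tabulate (σ ⟨$⟩ˡ_) i)) (inverseʳ σ))
    vw : ∀ i → lookup v (lookup w i) ≡ i
    vw i = trans (lookup∘tabulate (σ ⟨$⟩ˡ_) _) (trans (cong (σ ⟨$⟩ˡ_) (lookup∘tabulate (σ ⟨$⟩ʳ_) i)) (inverseˡ σ))
    -- The preimage under v is the image under σ.
    v-preserves : PreservesLines v
    v-preserves = All.tabulate λ {L} L∈ →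
      subst (_∈ lines G) (tabulate-cong λ i → cong (lookup L) (sym (lookup∘tabulate _ i))) (maps-lines L L∈)
    -- A line M is the image of some line L under σ, and then the preimage of M under w is L.
    w-preserves : PreservesLines w
    w-preserves = All.tabulate λ {M} M∈ → let L , L∈ , σL≡M = onto-lines M M∈ in
      subst (_∈ lines G) (sym (table-ext λ i → begin
        lookup (preimage (lookup w) M) i     ≡⟨ lookup∘tabulate _ i ⟩
        lookup M (lookup w i)                ≡⟨ cong (λ N → lookup N (lookup w i)) σL≡M ⟨
        lookup (image σ L) (lookup w i)      ≡⟨ lookup∘tabulate _ (lookup w i) ⟩
        lookup L (σ ⟨$⟩ˡ lookup w i)         ≡⟨ cong (lookup L) (trans (sym (lookup∘tabulate (σ ⟨$⟩ˡ_) _)) (vw i)) ⟩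
        lookup L i                           ∎)) L∈
      where open ≡-Reasoning

  transitive : Transitive G → ∀ x y → ∃ λ a → act a x ≡ y
  transitive G-transitive x y with G-transitive y x
  ... | σ , σ-aut , σy≡x = from-permutation σ σ-aut ,
    trans (lookup∘tabulate _ x) (trans (cong (σ ⟨$⟩ˡ_) (sym σy≡x)) (inverseˡ σ))

theorem2 : (a : ℕ) (G : AvoidanceGame (2 ^ a)) →
    Transitive G → ¬ PlayerIWin G
-- One point: Player I's first move leaves Player II without a move.
theorem2 zero G _ (moveI zero _ _ (moveII (zero , ()) _))
-- 2^(a+1) points: Player II mirrors with a fixed-point-free involutive automorphism.
theorem2 (suc a) G G-transitive =
  let z , z²≡ε , z-moves-all = Action.fixed-point-free-involution a refl
  in MirrorStrategy.mirror-strategy G (Aut.act z) (Action.square-ε-involutive z z²≡ε) z-moves-all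
       (Aut.act-preserves-lines z)
  where
  module Aut = AutomorphismGroup G
  module Finite = FiniteGroup Aut.isGroup Aut._≟_ Aut.elements Aut.elements-unique Aut.∈-elements
  module Action = Finite.TransitiveAction Aut.act Aut.act-∙ Aut.act-ε (Aut.transitive G-transitive) Aut.faithful
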